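{- Let $n\ge 2$ and $G_n=C_{2^n}\times C_{2^n}$ with orbit tree $T_n$. The automorphism group of $T_n$ as a rooted tree has order $3\cdot 2^{3(2^{n-1}-1)+1}$, while the automorphism group of $G_n$ has order $3\cdot 2^{4n-3}$. Furthermore, the $3\cdot 2^{4n-3}$ automorphisms of $G_n$ induce a subgroup of order $3\cdot 2^{3n-2}$ of the automorphism group of $T_n$.
   Context: $C_m=\{x/m: x\in\{0,\dots,m-1\}\}$ under addition mod $1$, and $G_n=C_{2^n}\times C_{2^n}$. The multiplier group $U(2^n)=\{u: u \text{ odd}, 1\le u\le 2^n\}$ acts on $G_n$ by $g\mapsto u\cdot g$. The orbit tree $T_n$ is the rooted tree whose nodes are the orbits of $G_n$ under this action: the root is $\{(0,0)\}$, the nodes at level $i$ are the orbits consisting of elements of order $2^i$ ($0\le i\le n$), and the parent of a node $M$ at level $i+1$ is the orbit containing $2x$ for any $x\in M$. (The root has three children, and every node at levels $1,\dots,n-1$ has two children.) An automorphism $\sigma$ of $G_n$ commutes with the multipliers and so permutes the orbits, inducing an automorphism of the rooted tree $T_n$. -}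

module Defs where

open import Data.Nat using (ℕ; zero; suc; _+_; _*_; _∸_; _^_; _≤_; NonZero)
open import Data.Nat.Properties using (m^n≢0)
open import Data.Nat.DivMod using (_mod_)
open import Data.Fin using (Fin; toℕ)
open import Data.Product using (Σ; _×_; _,_; proj₁; ∃)
open import Relation.Binary.PropositionalEquality using (_≡_)

M : ℕ → ℕ
M n = 2 ^ n

red : (n : ℕ) → ℕ → Fin (M n)
red n x = _mod_ x (M n) {{m^n≢0 2 n}}

-- C_{2^n}: the element x/2^n is represented by x : Fin (2^n).
C : ℕ → Set
C n = Fin (M n)

-- G_n = C_{2^n} × C_{2^n}
-- (a record so that n can be inferred from the type)
record G (n : ℕ) : Set where
  constructor ⟨_,_⟩
  field
    fst : C n
    snd : C n

infixl 6 _⊕_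
_⊕_ : ∀ {n} → G n → G n → G n
_⊕_ {n} ⟨ a , b ⟩ ⟨ c , d ⟩ = ⟨ red n (toℕ a + toℕ c) , red n (toℕ b + toℕ d) ⟩

zeroG : ∀ {n} → G n
zeroG {n} = ⟨ red n 0 , red n 0 ⟩

_·_ : ∀ {n} → ℕ → G n → G n
_·_ {n} u ⟨ a , b ⟩ = ⟨ red n (u * toℕ a) , red n (u * toℕ b) ⟩

Odd : ℕ → Set
Odd u = ∃ λ k → u ≡ suc (2 * k)

InU : ℕ → ℕ → Set
InU n u = Odd u × (1 ≤ u) × (u ≤ M n)

-- Orbit relation: x and y lie in the same U(2^n)-orbit.
-- The nodes of the orbit tree T_n are the classes of G n under this relation.
_∼_ : ∀ {n} → G n → G n → Set
_∼_ {n} x y = Σ ℕ λ u → InU n u × (y ≡ u · x)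

parent : ∀ {n} → G n → G n
parent x = x ⊕ x

-- Cardinality of a type modulo an equivalence relation:
-- a bijection between Fin k and A / ≈.

HasCard : (A : Set) → (A → A → Set) → ℕ → Set
HasCard A _≈_ k =
  Σ (Fin k → A) λ to → Σ (A → Fin k) λ from →
    (∀ i → from (to i) ≡ i) ×
    (∀ a → to (from a) ≈ a) ×
    (∀ a b → a ≈ b → from a ≡ from b)

-- A map on orbits is given by a map φ : G n → G n respecting ∼
-- (two such maps are equal iff they agree pointwise up to ∼).

RespOrb : ∀ {n} → (G n → G n) → Set
RespOrb {n} φ = ∀ (x y : G n) → x ∼ y → φ x ∼ φ y

IsTreeAut : ∀ {n} → (G n → G n) → Set
IsTreeAut {n} φ =
  RespOrb φ ×
  (Σ (G n → G n) λ ψ → RespOrb ψ × (∀ x → ψ (φ x) ∼ x) × (∀ x → φ (ψ x) ∼ x)) ×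
  (φ zeroG ∼ zeroG) ×
  (∀ x → φ (parent x) ∼ parent (φ x))

TreeAut : ℕ → Set
TreeAut n = Σ (G n → G n) IsTreeAut

_≈T_ : ∀ {n} → TreeAut n → TreeAut n → Set
_≈T_ {n} τ τ' = ∀ (x : G n) → proj₁ τ x ∼ proj₁ τ' x

IsGroupAut : ∀ {n} → (G n → G n) → Set
IsGroupAut {n} f =
  (∀ (x y : G n) → f (x ⊕ y) ≡ f x ⊕ f y) ×
  (Σ (G n → G n) λ g → (∀ x → g (f x) ≡ x) × (∀ x → f (g x) ≡ x))

GroupAut : ℕ → Set
GroupAut n = Σ (G n → G n) IsGroupAut

_≈G_ : ∀ {n} → GroupAut n → GroupAut n → Set
_≈G_ {n} σ σ' = ∀ (x : G n) → proj₁ σ x ≡ proj₁ σ' x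

Induced : ℕ → Set
Induced n = Σ (TreeAut n) λ τ → Σ (GroupAut n) λ σ → ∀ (x : G n) → proj₁ τ x ∼ proj₁ σ x

_≈I_ : ∀ {n} → Induced n → Induced n → Set
_≈I_ {n} a b = proj₁ a ≈T proj₁ b

-- Every U(2^n)-orbit of G_n at level i ≥ 1 contains exactly one element
-- 2^(n-i)·(1, t) with t < 2^i or 2^(n-i)·(2r, 1) with r < 2^(i-1), so the orbits at
-- level i carry labels below 3·2^(i-1), and the parent of label ℓ is ℓ mod 3·2^(i-2).
-- A tree automorphism is then a permutation of the three nodes of level 1 together
-- with, for each of the 3(2^(n-1) - 1) nodes of levels 1, …, n-1, a bit telling
-- whether it swaps the two children: 6·2^(3(2^(n-1)-1)) automorphisms.
-- Group automorphisms are the 2×2 matrices over ℤ/2^n with odd determinant: one of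
-- the six matrices of GL₂(𝔽₂) lifted in 2^(4(n-1)) ways.  Two of them induce the same
-- tree automorphism exactly when they differ by an odd scalar, and counting normal
-- forms modulo odd scalars gives 2^(3n-1) + 2^(3n-2) = 3·2^(3n-2) induced automorphisms.

module Submission where

open import Defs
open import Data.Nat using (ℕ; _+_; _*_; _∸_; _^_; _≤_)
open import Data.Product using (_×_)

open import Data.Nat
open import Data.Nat.Properties
open import Data.Nat.DivMod
open import Data.Nat.Divisibility using (m∣m*n; n∣m*n)
open import Data.Nat.Tactic.RingSolver using (solve-∀)
open import Data.Bool using (Bool; true; false; _xor_)
open import Data.Bool.Properties using (xor-assoc; xor-same; xor-identityʳ; true-xor; ¬-not)
open import Data.Fin using (Fin; toℕ; fromℕ<; combine; remQuot; splitAt; join)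
open import Data.Fin.Properties
  using (toℕ-injective; toℕ-fromℕ<; toℕ<n; remQuot-combine; combine-remQuot; splitAt-join; join-splitAt)
open import Data.Product using (Σ; _,_; proj₁; proj₂; ∃)
open import Data.Sum using (_⊎_; inj₁; inj₂)
open import Data.Product.Relation.Binary.Pointwise.NonDependent using () renaming (Pointwise to ×-Pointwise)
open import Data.Sum.Relation.Binary.Pointwise using (inj₁; inj₂) renaming (Pointwise to ⊎-Pointwise)
open import Data.Empty using (⊥; ⊥-elim)
open import Relation.Nullary using (¬_; yes; no; Dec; contradiction)
open import Relation.Binary.Definitions using (tri<; tri≈; tri>)
open import Relation.Binary.PropositionalEquality

-- Arithmetic modulo powers of two

module Congruence (d : ℕ) .{{_ : NonZero d}} where

  infix 4 _≅_
  _≅_ : ℕ → ℕ → Set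
  a ≅ b = a % d ≡ b % d

  ≡⇒≅ : ∀ {a b} → a ≡ b → a ≅ b
  ≡⇒≅ = cong (_% d)

  +-≅ : ∀ {a b c e} → a ≅ b → c ≅ e → a + c ≅ b + e
  +-≅ {a} {b} {c} {e} p q = begin
    (a + c) % d          ≡⟨ %-distribˡ-+ a c d ⟩
    (a % d + c % d) % d  ≡⟨ cong₂ (λ x y → (x + y) % d) p q ⟩
    (b % d + e % d) % d  ≡⟨ %-distribˡ-+ b e d ⟨
    (b + e) % d          ∎
    where open ≡-Reasoning

  *-≅ : ∀ {a b c e} → a ≅ b → c ≅ e → a * c ≅ b * e
  *-≅ {a} {b} {c} {e} p q = begin
    (a * c) % d            ≡⟨ %-distribˡ-* a c d ⟩
    (a % d * (c % d)) % d  ≡⟨ cong₂ (λ x y → (x * y) % d) p q ⟩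
    (b % d * (e % d)) % d  ≡⟨ %-distribˡ-* b e d ⟨
    (b * e) % d            ∎
    where open ≡-Reasoning

  %-≅ : ∀ a → a % d ≅ a
  %-≅ a = m%n%n≡m%n a d

  *d≅0 : ∀ k → k * d ≅ 0
  *d≅0 k = trans (m*n%n≡0 k d) (sym (m*n%n≡0 0 d))

  <⇒≅⇒≡ : ∀ {a b} → a < d → b < d → a ≅ b → a ≡ b
  <⇒≅⇒≡ a<d b<d p = trans (sym (m<n⇒m%n≡m a<d)) (trans p (m<n⇒m%n≡m b<d))

  -- Adding  d ∸ c % d  to  c  gives a multiple of d, which undoes the addition of c.
  +-cancelˡ-≅ : ∀ {a b} c → c + a ≅ c + b → a ≅ b
  +-cancelˡ-≅ {a} {b} c p = begin
    a % d                  ≡⟨ [m+kn]%n≡m%n a k d ⟨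
    (a + k * d) % d        ≡⟨ cong (λ z → (a + z) % d) c+e≡k*d ⟨
    (a + (c + e)) % d      ≡⟨ ≡⇒≅ (swap a c e) ⟩
    ((c + a) + e) % d      ≡⟨ +-≅ {c + a} {c + b} {e} {e} p refl ⟩
    ((c + b) + e) % d      ≡⟨ ≡⇒≅ (swap b c e) ⟨
    (b + (c + e)) % d      ≡⟨ cong (λ z → (b + z) % d) c+e≡k*d ⟩
    (b + k * d) % d        ≡⟨ [m+kn]%n≡m%n b k d ⟩
    b % d                  ∎
    where
    open ≡-Reasoning
    k = suc (c / d)
    e = d ∸ c % d
    swap : ∀ z c e → z + (c + e) ≡ (c + z) + e
    swap = solve-∀
    c+e≡k*d : c + e ≡ k * d
    c+e≡k*d = begin
      c + e                        ≡⟨ cong (_+ e) (m≡m%n+[m/n]*n c d) ⟩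
      c % d + (c / d) * d + e      ≡⟨ +-assoc (c % d) _ e ⟩
      c % d + ((c / d) * d + e)    ≡⟨ cong (c % d +_) (+-comm _ e) ⟩
      c % d + (e + (c / d) * d)    ≡⟨ +-assoc (c % d) e _ ⟨
      (c % d + e) + (c / d) * d    ≡⟨ cong (_+ (c / d) * d) (m+[n∸m]≡n (m%n≤n c d)) ⟩
      d + (c / d) * d              ∎

2^k≢0 : ∀ k → NonZero (2 ^ k)
2^k≢0 k = m^n≢0 2 k

2^k>0 : ∀ k → 2 ^ k > 0
2^k>0 = m^n>0 2

2^-mono-< : ∀ {i j} → i < j → 2 ^ i < 2 ^ j
2^-mono-< = ^-monoʳ-< 2 (s≤s (s≤s z≤n))

infixl 7 _%2^_
_%2^_ : ℕ → ℕ → ℕ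
x %2^ k = _%_ x (2 ^ k) {{2^k≢0 k}}

2^[n∸i]*2^i≡2^n : ∀ {i n} → i ≤ n → 2 ^ (n ∸ i) * 2 ^ i ≡ 2 ^ n
2^[n∸i]*2^i≡2^n {i} {n} i≤n = trans (sym (^-distribˡ-+-* 2 (n ∸ i) i)) (cong (2 ^_) (m∸n+n≡m i≤n))

%-reduce : ∀ a b .{{_ : NonZero a}} .{{_ : NonZero (a * b)}} {X Y} →
           X % (a * b) ≡ Y % (a * b) → X % a ≡ Y % a
%-reduce a b {X} {Y} p = begin
  X % a              ≡⟨ m∣n⇒o%n%m≡o%m a (a * b) X (m∣m*n b) ⟨
  X % (a * b) % a    ≡⟨ cong (_% a) p ⟩
  Y % (a * b) % a    ≡⟨ m∣n⇒o%n%m≡o%m a (a * b) Y (m∣m*n b) ⟩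
  Y % a              ∎
  where open ≡-Reasoning

%-scale : ∀ b o .{{_ : NonZero b}} .{{_ : NonZero (b * o)}} {X Y} →
          X % b ≡ Y % b → (X * o) % (b * o) ≡ (Y * o) % (b * o)
%-scale b o {X} {Y} p = begin
  (X * o) % (b * o)  ≡⟨ m%n*o≡m*o%[n*o] X b o ⟨
  X % b * o          ≡⟨ cong (_* o) p ⟩
  Y % b * o          ≡⟨ m%n*o≡m*o%[n*o] Y b o ⟩
  (Y * o) % (b * o)  ∎
  where open ≡-Reasoning

module _ {i n : ℕ} (i≤n : i ≤ n) where
  private
    instance
      _ = 2^k≢0 n
      _ = m*n≢0 (2 ^ i) (2 ^ (n ∸ i)) {{2^k≢0 i}} {{2^k≢0 (n ∸ i)}}
    2^i*2^[n∸i]≡2^n : 2 ^ i * 2 ^ (n ∸ i) ≡ 2 ^ n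
    2^i*2^[n∸i]≡2^n = trans (*-comm (2 ^ i) _) (2^[n∸i]*2^i≡2^n i≤n)

  %2^-scale : ∀ {X Y} → X %2^ i ≡ Y %2^ i → (2 ^ (n ∸ i) * X) %2^ n ≡ (2 ^ (n ∸ i) * Y) %2^ n
  %2^-scale {X} {Y} p =
    trans (sym (%-congʳ 2^i*2^[n∸i]≡2^n))
      (trans (subst₂ (λ A B → A % (2 ^ i * 2 ^ (n ∸ i)) ≡ B % (2 ^ i * 2 ^ (n ∸ i)))
                     (*-comm X (2 ^ (n ∸ i))) (*-comm Y (2 ^ (n ∸ i)))
                     (%-scale (2 ^ i) (2 ^ (n ∸ i)) {{2^k≢0 i}} p))
             (%-congʳ 2^i*2^[n∸i]≡2^n))

  %2^-reduce : ∀ {X Y} → X %2^ n ≡ Y %2^ n → X %2^ i ≡ Y %2^ i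
  %2^-reduce p =
    %-reduce (2 ^ i) (2 ^ (n ∸ i)) {{2^k≢0 i}}
      (trans (%-congʳ 2^i*2^[n∸i]≡2^n) (trans p (sym (%-congʳ 2^i*2^[n∸i]≡2^n))))

%2-cases : ∀ ℓ → (ℓ % 2 ≡ 0) ⊎ (ℓ % 2 ≡ 1)
%2-cases ℓ with ℓ % 2 | m%n<n ℓ 2
... | 0 | _ = inj₁ refl
... | 1 | _ = inj₂ refl
... | suc (suc _) | s≤s (s≤s ())

%3-cases : ∀ ℓ → (ℓ % 3 ≡ 0) ⊎ ((ℓ % 3 ≡ 1) ⊎ (ℓ % 3 ≡ 2))
%3-cases ℓ with ℓ % 3 | m%n<n ℓ 3
... | 0 | _ = inj₁ refl
... | 1 | _ = inj₂ (inj₁ refl)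
... | 2 | _ = inj₂ (inj₂ refl)
... | suc (suc (suc _)) | s≤s (s≤s (s≤s ()))

divMod-unique : ∀ o k d .{{_ : NonZero d}} → o < d → (o + k * d) / d ≡ k × (o + k * d) % d ≡ o
divMod-unique o k d o<d =
  trans (+-distrib-/-∣ʳ o (n∣m*n k)) (cong₂ _+_ (m<n⇒m/n≡0 o<d) (m*n/n≡m k d)) ,
  trans ([m+kn]%n≡m%n o k d) (m<n⇒m%n≡m o<d)

odd-* : ∀ {a b} → Odd a → Odd b → Odd (a * b)
odd-* (i , refl) (j , refl) = i + j + 2 * i * j , expand i j
  where
  expand : ∀ i j → suc (2 * i) * suc (2 * j) ≡ suc (2 * (i + j + 2 * i * j))
  expand = solve-∀

odd-^ : ∀ {a} k → Odd a → Odd (a ^ k)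
odd-^ zero    oa = 0 , refl
odd-^ (suc k) oa = odd-* oa (odd-^ k oa)

odd⇒%2≡1 : ∀ {x} → Odd x → x % 2 ≡ 1
odd⇒%2≡1 (j , refl) = trans (cong (_% 2) (regroup j)) ([m+kn]%n≡m%n 1 j 2)
  where
  regroup : ∀ j → suc (2 * j) ≡ 1 + j * 2
  regroup = solve-∀

%2≡1⇒odd : ∀ {x} → x % 2 ≡ 1 → Odd x
%2≡1⇒odd {x} p =
  x / 2 , trans (m≡m%n+[m/n]*n x 2) (trans (cong (_+ (x / 2) * 2) p) (cong suc (*-comm (x / 2) 2)))

odd-%-even : ∀ {x} P .{{_ : NonZero P}} → Odd x → Odd (_%_ x (2 * P) {{m*n≢0 2 P}})
odd-%-even {x} P ox =
  %2≡1⇒odd (trans (m∣n⇒o%n%m≡o%m 2 (2 * P) x {{_}} {{m*n≢0 2 P}} (m∣m*n P)) (odd⇒%2≡1 ox))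

-- Squaring  1 + 2^(k+1) m  gives  1 + 2^(k+2) (m + 2^k m²).
odd^2^k : ∀ {a} → Odd a → ∀ k → ∃ λ m → a ^ (2 ^ k) ≡ 1 + 2 ^ suc k * m
odd^2^k (j , refl) zero = j , *-identityʳ _
odd^2^k {a} oa (suc k) with odd^2^k oa k
... | m , e = m + 2 ^ k * m * m , (begin
  a ^ (2 * 2 ^ k)                        ≡⟨ cong (λ z → a ^ (2 ^ k + z)) (+-identityʳ (2 ^ k)) ⟩
  a ^ (2 ^ k + 2 ^ k)                    ≡⟨ ^-distribˡ-+-* a (2 ^ k) (2 ^ k) ⟩
  a ^ (2 ^ k) * a ^ (2 ^ k)              ≡⟨ cong₂ _*_ e e ⟩
  (1 + 2 * P * m) * (1 + 2 * P * m)      ≡⟨ square m P ⟩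
  1 + 2 * (2 * P) * (m + P * m * m)      ∎)
  where
  open ≡-Reasoning
  P = 2 ^ k
  square : ∀ m P → (1 + 2 * P * m) * (1 + 2 * P * m) ≡ 1 + 2 * (2 * P) * (m + P * m * m)
  square = solve-∀

-- The inverse of an odd a modulo 2^n: since a^(2^n) ≡ 1, it is a^(2^n - 1).
inv : ℕ → ℕ → ℕ
inv n a = (a ^ (2 ^ n ∸ 1)) %2^ n

inv-inverseˡ : ∀ n {a} → Odd a → (inv n a * a) %2^ n ≡ 1 %2^ n
inv-inverseˡ n {a} oa with odd^2^k oa n
... | m , e = begin
  ((a ^ (2 ^ n ∸ 1)) % 2 ^ n * a) % 2 ^ n  ≡⟨ *-≅ {(a ^ (2 ^ n ∸ 1)) % 2 ^ n} {_} {a} (%-≅ _) refl ⟩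
  (a ^ (2 ^ n ∸ 1) * a) % 2 ^ n            ≡⟨ cong (_% 2 ^ n) a^[2^n∸1]*a ⟩
  (1 + 2 ^ suc n * m) % 2 ^ n              ≡⟨ cong (λ z → (1 + z) % 2 ^ n) (regroup (2 ^ n) m) ⟩
  (1 + (2 * m) * 2 ^ n) % 2 ^ n            ≡⟨ [m+kn]%n≡m%n 1 (2 * m) (2 ^ n) ⟩
  1 % 2 ^ n                                ∎
  where
  open ≡-Reasoning
  instance _ = 2^k≢0 n
  open Congruence (2 ^ n)
  regroup : ∀ P m → 2 * P * m ≡ (2 * m) * P
  regroup = solve-∀
  a^[2^n∸1]*a : a ^ (2 ^ n ∸ 1) * a ≡ 1 + 2 ^ suc n * m
  a^[2^n∸1]*a = trans (*-comm _ a) (trans (cong (a ^_) (m+[n∸m]≡n (2^k>0 n))) e)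

odd-inv : ∀ n {a} → 1 ≤ n → Odd a → Odd (inv n a)
odd-inv (suc n) _ oa = odd-%-even (2 ^ n) {{2^k≢0 n}} (odd-^ (2 ^ suc n ∸ 1) oa)

-- Reducing modulo 2^(k+1), the left side is 2^k and the right side is 0.
odd*2^k≢2^[1+k]*z : ∀ {u} n k z → Odd u → k < n → (u * 2 ^ k) %2^ n ≢ (2 ^ suc k * z) %2^ n
odd*2^k≢2^[1+k]*z n k z (j , refl) k<n eq =
  <⇒≢ (2^k>0 k) (sym (trans (sym lhs) (trans (%2^-reduce k<n eq) rhs)))
  where
  P = 2 ^ k
  instance _ = 2^k≢0 (suc k)
  split : ∀ j P → suc (2 * j) * P ≡ P + j * (2 * P)
  split = solve-∀
  lhs : (suc (2 * j) * P) % (2 * P) ≡ P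
  lhs = trans (cong (_% (2 * P)) (split j P))
          (trans ([m+kn]%n≡m%n P j (2 * P)) (m<n⇒m%n≡m (2^-mono-< {k} {suc k} ≤-refl)))
  rhs : (2 * P * z) % (2 * P) ≡ 0
  rhs = trans (cong (_% (2 * P)) (*-comm (2 * P) z)) (m*n%n≡0 z (2 * P))

-- The orbits of G_n

module Coordinates (n' : ℕ) where

  -- n ≥ 1, so that residues of odd numbers modulo 2^n are odd.
  n : ℕ
  n = suc n'

  instance
    2^n≢0 : NonZero (2 ^ n)
    2^n≢0 = 2^k≢0 n

  open Congruence (2 ^ n) public

  c₁ c₂ : G n → ℕ
  c₁ x = toℕ (G.fst x)
  c₂ x = toℕ (G.snd x)

  mk : ℕ → ℕ → G n
  mk a b = ⟨ red n a , red n b ⟩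

  c₁-mk : ∀ a b → c₁ (mk a b) ≡ a % 2 ^ n
  c₁-mk a b = toℕ-fromℕ< _

  c₂-mk : ∀ a b → c₂ (mk a b) ≡ b % 2 ^ n
  c₂-mk a b = toℕ-fromℕ< _

  c₁< : ∀ x → c₁ x < 2 ^ n
  c₁< x = toℕ<n (G.fst x)

  c₂< : ∀ x → c₂ x < 2 ^ n
  c₂< x = toℕ<n (G.snd x)

  c₁-mk-≅ : ∀ a b → c₁ (mk a b) ≅ a
  c₁-mk-≅ a b = trans (cong (_% 2 ^ n) (c₁-mk a b)) (%-≅ a)

  c₂-mk-≅ : ∀ a b → c₂ (mk a b) ≅ b
  c₂-mk-≅ a b = trans (cong (_% 2 ^ n) (c₂-mk a b)) (%-≅ b)

  red-cong : ∀ {a b} → a ≅ b → red n a ≡ red n b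
  red-cong {a} {b} p = toℕ-injective (trans (toℕ-fromℕ< _) (trans p (sym (toℕ-fromℕ< _))))

  red-toℕ : ∀ (a : Fin (2 ^ n)) → red n (toℕ a) ≡ a
  red-toℕ a = toℕ-injective (trans (toℕ-fromℕ< _) (m<n⇒m%n≡m (toℕ<n a)))

  mk-η : ∀ x → mk (c₁ x) (c₂ x) ≡ x
  mk-η ⟨ a , b ⟩ = cong₂ ⟨_,_⟩ (red-toℕ a) (red-toℕ b)

  mk-cong : ∀ {a b c e} → a ≅ c → b ≅ e → mk a b ≡ mk c e
  mk-cong p q = cong₂ ⟨_,_⟩ (red-cong p) (red-cong q)

  mk-injective₁ : ∀ {a b c e} → mk a b ≡ mk c e → a ≅ c
  mk-injective₁ {a} {b} {c} {e} p = trans (sym (c₁-mk a b)) (trans (cong c₁ p) (c₁-mk c e))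

  mk-injective₂ : ∀ {a b c e} → mk a b ≡ mk c e → b ≅ e
  mk-injective₂ {a} {b} {c} {e} p = trans (sym (c₂-mk a b)) (trans (cong c₂ p) (c₂-mk c e))

  G-≡ : ∀ {x y : G n} → c₁ x ≅ c₁ y → c₂ x ≅ c₂ y → x ≡ y
  G-≡ {x} {y} p q = trans (sym (mk-η x)) (trans (mk-cong p q) (mk-η y))

  ·-mk : ∀ u a b → u · mk a b ≡ mk (u * a) (u * b)
  ·-mk u a b = mk-cong (*-≅ {u} refl (c₁-mk-≅ a b)) (*-≅ {u} refl (c₂-mk-≅ a b))

  ⊕-mk : ∀ a b c e → mk a b ⊕ mk c e ≡ mk (a + c) (b + e)
  ⊕-mk a b c e = mk-cong (+-≅ (c₁-mk-≅ a b) (c₁-mk-≅ c e)) (+-≅ (c₂-mk-≅ a b) (c₂-mk-≅ c e))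

  ·-assoc : ∀ u v x → v · (u · x) ≡ (v * u) · x
  ·-assoc u v x = trans (·-mk v _ _) (mk-cong (≡⇒≅ (sym (*-assoc v u (c₁ x)))) (≡⇒≅ (sym (*-assoc v u (c₂ x)))))

  ·-identityˡ : ∀ x → 1 · x ≡ x
  ·-identityˡ x = trans (mk-cong (≡⇒≅ (*-identityˡ (c₁ x))) (≡⇒≅ (*-identityˡ (c₂ x)))) (mk-η x)

  ·-congʳ : ∀ {u v} x → u ≅ v → u · x ≡ v · x
  ·-congʳ x p = mk-cong (*-≅ p refl) (*-≅ p refl)

  ·-distrib-⊕ : ∀ u x y → u · (x ⊕ y) ≡ u · x ⊕ u · y
  ·-distrib-⊕ u x y =
    trans (·-mk u _ _)
      (trans (mk-cong (≡⇒≅ (*-distribˡ-+ u (c₁ x) (c₁ y))) (≡⇒≅ (*-distribˡ-+ u (c₂ x) (c₂ y))))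
             (sym (⊕-mk _ _ _ _)))

  -- Any odd multiplier acts like its residue modulo 2^n, which lies in U(2^n).
  ∼-intro : ∀ {u} (x y : G n) → Odd u → y ≡ u · x → x ∼ y
  ∼-intro {u} x y ou e =
    u % 2 ^ n , (odd-u% , odd⇒≥1 odd-u% , m%n≤n u (2 ^ n)) , trans e (·-congʳ x (sym (%-≅ u)))
    where
    odd-u% : Odd (u % 2 ^ n)
    odd-u% = odd-%-even (2 ^ n') {{2^k≢0 n'}} ou
    odd⇒≥1 : ∀ {v} → Odd v → 1 ≤ v
    odd⇒≥1 (k , refl) = s≤s z≤n

  ∼-refl : ∀ {x : G n} → x ∼ x
  ∼-refl {x} = ∼-intro x x (0 , refl) (sym (·-identityˡ x))

  ≡⇒∼ : ∀ {x y : G n} → x ≡ y → x ∼ y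
  ≡⇒∼ refl = ∼-refl

  ∼-trans : ∀ {x y z : G n} → x ∼ y → y ∼ z → x ∼ z
  ∼-trans {x} {y} {z} (u , (ou , _) , e₁) (v , (ov , _) , e₂) =
    ∼-intro x z (odd-* ov ou) (trans e₂ (trans (cong (v ·_) e₁) (·-assoc u v x)))

  ∼-sym : ∀ {x y : G n} → x ∼ y → y ∼ x
  ∼-sym {x} {y} (u , (ou , _) , e) = ∼-intro y x (odd-inv n (s≤s z≤n) ou) (sym (begin
    inv n u · y          ≡⟨ cong (inv n u ·_) e ⟩
    inv n u · (u · x)    ≡⟨ ·-assoc u (inv n u) x ⟩
    (inv n u * u) · x    ≡⟨ ·-congʳ x (inv-inverseˡ n ou) ⟩
    1 · x                ≡⟨ ·-identityˡ x ⟩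
    x                    ∎))
    where open ≡-Reasoning

  parent-∼ : ∀ {x y : G n} → x ∼ y → parent x ∼ parent y
  parent-∼ {x} {y} (u , iu , e) = u , iu , trans (cong (λ z → z ⊕ z) e) (sym (·-distrib-⊕ u x x))

width : ℕ → ℕ
width zero    = 1
width (suc i) = 3 * 2 ^ i

width≢0 : ∀ i → NonZero (width i)
width≢0 zero    = _
width≢0 (suc i) = m*n≢0 3 (2 ^ i) {{_}} {{2^k≢0 i}}

infixl 7 _%width_
_%width_ : ℕ → ℕ → ℕ
x %width i = _%_ x (width i) {{width≢0 i}}

-- At level i+1 the label c + 3r (c < 3, r < 2^i) names the orbit of
-- 2^(n-i-1)·(repX c r , repY c r), i.e. of (1, 2r), (1, 2r+1) or (2r, 1).
repX repY : ℕ → ℕ → ℕ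
repX 0 r = 1
repX 1 r = 1
repX (suc (suc _)) r = 2 * r
repY 0 r = 2 * r
repY 1 r = 1 + 2 * r
repY (suc (suc _)) r = 1

m∸n≡1+[m∸1+n] : ∀ {j n} → suc j ≤ n → n ∸ j ≡ suc (n ∸ suc j)
m∸n≡1+[m∸1+n] {zero}  {suc n} _       = refl
m∸n≡1+[m∸1+n] {suc j} {suc n} (s≤s p) = m∸n≡1+[m∸1+n] {j} {n} p

module Orbits (n' : ℕ) where

  open Coordinates n' public

  scale : ℕ → ℕ
  scale i = 2 ^ (n ∸ i)

  repAt : ℕ → ℕ → ℕ → G n
  repAt zero    c r = mk 0 0
  repAt (suc i) c r = mk (scale (suc i) * repX c r) (scale (suc i) * repY c r)

  rep : ℕ → ℕ → G n
  rep i ℓ = repAt i (ℓ % 3) (ℓ / 3)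

  IsNode : ℕ → ℕ → Set
  IsNode i ℓ = i ≤ n × ℓ < width i

  Order∣2^ : ℕ → G n → Set
  Order∣2^ k x = (2 ^ k) · x ≡ mk 0 0

  ·-mk00 : ∀ u → u · mk 0 0 ≡ mk 0 0
  ·-mk00 u = trans (·-mk u 0 0) (cong₂ mk (*-zeroʳ u) (*-zeroʳ u))

  Order∣2^-∼ : ∀ {k x y} → x ∼ y → Order∣2^ k x → Order∣2^ k y
  Order∣2^-∼ {k} {x} {y} (u , _ , refl) z = begin
    (2 ^ k) · (u · x)   ≡⟨ ·-assoc u (2 ^ k) x ⟩
    (2 ^ k * u) · x     ≡⟨ cong (_· x) (*-comm (2 ^ k) u) ⟩
    (u * 2 ^ k) · x     ≡⟨ ·-assoc (2 ^ k) u x ⟨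
    u · ((2 ^ k) · x)   ≡⟨ cong (u ·_) z ⟩
    u · mk 0 0          ≡⟨ ·-mk00 u ⟩
    mk 0 0              ∎
    where open ≡-Reasoning

  Order∣2^-repAt : ∀ i c r → i ≤ n → Order∣2^ i (repAt i c r)
  Order∣2^-repAt zero    c r _   = ·-identityˡ (mk 0 0)
  Order∣2^-repAt (suc i) c r i≤n =
    trans (·-mk (2 ^ suc i) _ _) (mk-cong (killed (repX c r)) (killed (repY c r)))
    where
    regroup : ∀ A B X → A * (B * X) ≡ X * (B * A)
    regroup = solve-∀
    killed : ∀ X → 2 ^ suc i * (scale (suc i) * X) ≅ 0
    killed X = trans (cong (_% 2 ^ n) (trans (regroup (2 ^ suc i) (scale (suc i)) X)
                                             (cong (X *_) (2^[n∸i]*2^i≡2^n i≤n))))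
                     (*d≅0 X)

  2^k*scale≇0 : ∀ {k i} → k < i → i ≤ n → ¬ (2 ^ k * (scale i * 1) ≅ 0)
  2^k*scale≇0 {k} {i} k<i i≤n p =
    <⇒≢ (2^k>0 (k + (n ∸ i))) (sym (trans (sym lhs) (trans p (m<n⇒m%n≡m (2^k>0 n)))))
    where
    2^k*scale≡ : 2 ^ k * (scale i * 1) ≡ 2 ^ (k + (n ∸ i))
    2^k*scale≡ = trans (cong (2 ^ k *_) (*-identityʳ _)) (sym (^-distribˡ-+-* 2 k (n ∸ i)))
    k+[n∸i]<n : k + (n ∸ i) < n
    k+[n∸i]<n = subst (_≤ n) (+-comm (n ∸ i) (suc k))
                  (subst (λ z → (n ∸ i) + suc k ≤ z) (m∸n+n≡m i≤n) (+-monoʳ-≤ (n ∸ i) k<i))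
    lhs : (2 ^ k * (scale i * 1)) % 2 ^ n ≡ 2 ^ (k + (n ∸ i))
    lhs = trans (cong (_% 2 ^ n) 2^k*scale≡) (m<n⇒m%n≡m (2^-mono-< k+[n∸i]<n))

  -- One coordinate of every representative is  scale i  times 1.
  ¬Order∣2^-rep : ∀ {k} i ℓ → k < i → i ≤ n → ¬ Order∣2^ k (rep i ℓ)
  ¬Order∣2^-rep {k} (suc i) ℓ k<i i≤n z = unit-coordinate (%3-cases ℓ)
    where
    S = scale (suc i)
    r = ℓ / 3
    z′ : mk (2 ^ k * (S * repX (ℓ % 3) r)) (2 ^ k * (S * repY (ℓ % 3) r)) ≡ mk 0 0
    z′ = trans (sym (·-mk (2 ^ k) _ _)) z
    unit-coordinate : (ℓ % 3 ≡ 0) ⊎ ((ℓ % 3 ≡ 1) ⊎ (ℓ % 3 ≡ 2)) → ⊥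
    unit-coordinate (inj₁ e)        = 2^k*scale≇0 k<i i≤n (subst (λ c → 2 ^ k * (S * repX c r) ≅ 0) e (mk-injective₁ z′))
    unit-coordinate (inj₂ (inj₁ e)) = 2^k*scale≇0 k<i i≤n (subst (λ c → 2 ^ k * (S * repX c r) ≅ 0) e (mk-injective₁ z′))
    unit-coordinate (inj₂ (inj₂ e)) = 2^k*scale≇0 k<i i≤n (subst (λ c → 2 ^ k * (S * repY c r) ≅ 0) e (mk-injective₂ z′))

  rep-level-injective : ∀ {i j ℓ ℓ'} → IsNode i ℓ → IsNode j ℓ' → rep i ℓ ∼ rep j ℓ' → i ≡ j
  rep-level-injective {i} {j} {ℓ} {ℓ'} (i≤n , _) (j≤n , _) p with <-cmp i j
  ... | tri≈ _ e _  = e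
  ... | tri< i<j _ _ = ⊥-elim (¬Order∣2^-rep j ℓ' i<j j≤n (Order∣2^-∼ {i} p (Order∣2^-repAt i (ℓ % 3) (ℓ / 3) i≤n)))
  ... | tri> _ _ j<i = ⊥-elim (¬Order∣2^-rep i ℓ j<i i≤n (Order∣2^-∼ {j} (∼-sym p) (Order∣2^-repAt j (ℓ' % 3) (ℓ' / 3) j≤n)))

  module SameLevel (i' : ℕ) (i≤n : suc i' ≤ n) where

    private
      i = suc i'
      S = scale i
      instance S≢0 = 2^k≢0 (n ∸ i)

    S*t<2^n : ∀ {t} → t < 2 ^ i → S * t < 2 ^ n
    S*t<2^n {t} t< = subst (S * t <_) (2^[n∸i]*2^i≡2^n i≤n) (*-monoʳ-< S t<)

    c+2r< : ∀ {c r} → c ≤ 1 → r < 2 ^ i' → c + 2 * r < 2 ^ i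
    c+2r< {c} {r} c≤1 r< = ≤-trans (+-monoˡ-≤ (2 * r) (s≤s c≤1)) (≤-trans (≤-reflexive (2+2r≡2[1+r] r)) (*-monoʳ-≤ 2 r<))
      where
      2+2r≡2[1+r] : ∀ r → 2 + 2 * r ≡ 2 * suc r
      2+2r≡2[1+r] = solve-∀

    fixes-S⇒fixes-S* : ∀ {u} t → u * (S * 1) ≅ S * 1 → u * (S * t) ≅ S * t
    fixes-S⇒fixes-S* {u} t e = begin
      (u * (S * t)) % 2 ^ n     ≡⟨ cong (_% 2 ^ n) (regroup u S t) ⟩
      (u * (S * 1) * t) % 2 ^ n ≡⟨ *-≅ {u * (S * 1)} {S * 1} {t} e refl ⟩
      (S * 1 * t) % 2 ^ n       ≡⟨ cong (λ z → (z * t) % 2 ^ n) (*-identityʳ S) ⟩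
      (S * t) % 2 ^ n           ∎
      where
      open ≡-Reasoning
      regroup : ∀ u S t → u * (S * t) ≡ u * (S * 1) * t
      regroup = solve-∀

    other-coordinate : ∀ {u t t'} → t < 2 ^ i → t' < 2 ^ i →
                       u * (S * 1) ≅ S * 1 → u * (S * t) ≅ S * t' → t ≡ t'
    other-coordinate {u} {t} t< t'< fix e =
      *-cancelˡ-≡ _ _ S (<⇒≅⇒≡ (S*t<2^n t<) (S*t<2^n t'<) (trans (sym (fixes-S⇒fixes-S* {u} t fix)) e))

    odd*S≇S*even : ∀ {u} r' → Odd u → ¬ (u * (S * 1) ≅ S * (2 * r'))
    odd*S≇S*even {u} r' ou e = odd*2^k≢2^[1+k]*z n (n ∸ i) r' ou (s≤s (m∸n≤m n' i'))
      (trans (cong (_% 2 ^ n) (cong (u *_) (sym (*-identityʳ S)))) (trans e (cong (_% 2 ^ n) (regroup S r'))))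
      where
      regroup : ∀ S r → S * (2 * r) ≡ 2 * S * r
      regroup = solve-∀

    odd*S*even≇S : ∀ {u} r → Odd u → ¬ (u * (S * (2 * r)) ≅ S * 1)
    odd*S*even≇S {u} r ou e = odd*2^k≢2^[1+k]*z n (n ∸ i) (u * r) (0 , refl) (s≤s (m∸n≤m n' i'))
      (trans (cong (_% 2 ^ n) (*-comm 1 S)) (trans (sym e) (cong (_% 2 ^ n) (regroup u S r))))
      where
      regroup : ∀ u S r → u * (S * (2 * r)) ≡ 2 * S * (u * r)
      regroup = solve-∀

    -- An odd multiple of S is never S times an even number, so both representatives have
    -- S in the same coordinate; u then fixes S, hence also the other coordinate.
    repXY-injective : ∀ {u} c c' r r' → c < 3 → c' < 3 → r < 2 ^ i' → r' < 2 ^ i' → Odd u →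
                      u * (S * repX c r) ≅ S * repX c' r' → u * (S * repY c r) ≅ S * repY c' r' →
                      c ≡ c' × r ≡ r'
    repXY-injective {u} 0 0 r r' _ _ r< r'< _ ex ey =
      refl , *-cancelˡ-≡ r r' 2 (other-coordinate {u} (c+2r< z≤n r<) (c+2r< z≤n r'<) ex ey)
    repXY-injective {u} 0 1 r r' _ _ r< r'< _ ex ey =
      ⊥-elim (even≢odd r r' (other-coordinate {u} (c+2r< z≤n r<) (c+2r< (s≤s z≤n) r'<) ex ey))
    repXY-injective {u} 1 0 r r' _ _ r< r'< _ ex ey =
      ⊥-elim (even≢odd r' r (sym (other-coordinate {u} (c+2r< (s≤s z≤n) r<) (c+2r< z≤n r'<) ex ey)))
    repXY-injective {u} 1 1 r r' _ _ r< r'< _ ex ey =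
      refl , *-cancelˡ-≡ r r' 2 (suc-injective (other-coordinate {u} (c+2r< (s≤s z≤n) r<) (c+2r< (s≤s z≤n) r'<) ex ey))
    repXY-injective {u} 2 2 r r' _ _ r< r'< _ ex ey =
      refl , *-cancelˡ-≡ r r' 2 (other-coordinate {u} (c+2r< z≤n r<) (c+2r< z≤n r'<) ey ex)
    repXY-injective 0 2 r r' _ _ _ _ ou ex _ = ⊥-elim (odd*S≇S*even r' ou ex)
    repXY-injective 1 2 r r' _ _ _ _ ou ex _ = ⊥-elim (odd*S≇S*even r' ou ex)
    repXY-injective 2 0 r r' _ _ _ _ ou ex _ = ⊥-elim (odd*S*even≇S r ou ex)
    repXY-injective 2 1 r r' _ _ _ _ ou ex _ = ⊥-elim (odd*S*even≇S r ou ex)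
    repXY-injective (suc (suc (suc _))) _ _ _ (s≤s (s≤s (s≤s ()))) _ _ _ _ _ _
    repXY-injective _ (suc (suc (suc _))) _ _ _ (s≤s (s≤s (s≤s ()))) _ _ _ _ _

    rep-label-injective : ∀ {ℓ ℓ'} → ℓ < width i → ℓ' < width i → rep i ℓ ∼ rep i ℓ' → ℓ ≡ ℓ'
    rep-label-injective {ℓ} {ℓ'} ℓ< ℓ'< (u , (ou , _) , e) = begin
      ℓ                        ≡⟨ m≡m%n+[m/n]*n ℓ 3 ⟩
      ℓ % 3 + (ℓ / 3) * 3      ≡⟨ cong₂ (λ a b → a + b * 3) (proj₁ cr) (proj₂ cr) ⟩
      ℓ' % 3 + (ℓ' / 3) * 3    ≡⟨ m≡m%n+[m/n]*n ℓ' 3 ⟨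
      ℓ'                       ∎
      where
      open ≡-Reasoning
      /3< : ∀ {m} → m < width i → m / 3 < 2 ^ i'
      /3< {m} p = m<n*o⇒m/o<n (subst (m <_) (*-comm 3 (2 ^ i')) p)
      e′ : mk (u * (S * repX (ℓ % 3) (ℓ / 3))) (u * (S * repY (ℓ % 3) (ℓ / 3))) ≡ rep i ℓ'
      e′ = sym (trans e (·-mk u _ _))
      cr = repXY-injective (ℓ % 3) (ℓ' % 3) (ℓ / 3) (ℓ' / 3) (m%n<n ℓ 3) (m%n<n ℓ' 3) (/3< ℓ<) (/3< ℓ'<) ou
             (mk-injective₁ e′) (mk-injective₂ e′)

  rep-∼-injective : ∀ {i j ℓ ℓ'} → IsNode i ℓ → IsNode j ℓ' → rep i ℓ ∼ rep j ℓ' → i ≡ j × ℓ ≡ ℓ'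
  rep-∼-injective {i} {j} {ℓ} {ℓ'} vi vj p with rep-level-injective vi vj p
  rep-∼-injective {zero}   {_} {0}     {0}     _          _          _ | refl = refl , refl
  rep-∼-injective {zero}   {_} {suc _} {_}     (_ , s≤s ()) _        _ | refl
  rep-∼-injective {zero}   {_} {_}     {suc _} _          (_ , s≤s ()) _ | refl
  rep-∼-injective {suc i'} {_} {ℓ}     {ℓ'}    (i≤n , ℓ<) (_ , ℓ'<)  p | refl =
    refl , SameLevel.rep-label-injective i' i≤n ℓ< ℓ'< p

label₁ : ℕ → ℕ
label₁ t = t % 2 + 3 * (t / 2)

label₂ : ℕ → ℕ
label₂ r = 2 + 3 * r

repXY-label₁ : ∀ t → repX (label₁ t % 3) (label₁ t / 3) ≡ 1 × repY (label₁ t % 3) (label₁ t / 3) ≡ t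
repXY-label₁ t = subst (λ (cr : ℕ × ℕ) → repX (proj₁ cr) (proj₂ cr) ≡ 1 × repY (proj₁ cr) (proj₂ cr) ≡ t)
                   (sym (cong₂ _,_ t%3 t/3)) (digits (%2-cases t))
  where
  dm = divMod-unique (t % 2) (t / 2) 3 (≤-trans (m%n<n t 2) (s≤s (s≤s z≤n)))
  t%3 : label₁ t % 3 ≡ t % 2
  t%3 = trans (cong (λ z → (t % 2 + z) % 3) (*-comm 3 (t / 2))) (proj₂ dm)
  t/3 : label₁ t / 3 ≡ t / 2
  t/3 = trans (cong (λ z → (t % 2 + z) / 3) (*-comm 3 (t / 2))) (proj₁ dm)
  t≡ : t ≡ t % 2 + 2 * (t / 2)
  t≡ = trans (m≡m%n+[m/n]*n t 2) (cong (t % 2 +_) (*-comm (t / 2) 2))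
  digits : (t % 2 ≡ 0) ⊎ (t % 2 ≡ 1) → repX (t % 2) (t / 2) ≡ 1 × repY (t % 2) (t / 2) ≡ t
  digits (inj₁ e) rewrite e = refl , sym (subst (λ c → t ≡ c + 2 * (t / 2)) e t≡)
  digits (inj₂ e) rewrite e = refl , sym (subst (λ c → t ≡ c + 2 * (t / 2)) e t≡)

label₁< : ∀ t j → t < 2 ^ suc j → label₁ t < width (suc j)
label₁< t j t< =
  ≤-trans (+-monoˡ-≤ (3 * (t / 2)) {suc (t % 2)} {3} (≤-trans (m%n<n t 2) (s≤s (s≤s z≤n))))
    (≤-trans (≤-reflexive (3+3r≡3[1+r] (t / 2)))
             (*-monoʳ-≤ 3 {suc (t / 2)} {2 ^ j} (m<n*o⇒m/o<n (subst (t <_) (*-comm 2 (2 ^ j)) t<))))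
  where
  3+3r≡3[1+r] : ∀ r → 3 + 3 * r ≡ 3 * suc r
  3+3r≡3[1+r] = solve-∀

repXY-label₂ : ∀ r → repX (label₂ r % 3) (label₂ r / 3) ≡ 2 * r × repY (label₂ r % 3) (label₂ r / 3) ≡ 1
repXY-label₂ r = subst (λ (cr : ℕ × ℕ) → repX (proj₁ cr) (proj₂ cr) ≡ 2 * r × repY (proj₁ cr) (proj₂ cr) ≡ 1)
                   (sym (cong₂ _,_ (trans (cong (λ z → (2 + z) % 3) (*-comm 3 r)) (proj₂ dm))
                                   (trans (cong (λ z → (2 + z) / 3) (*-comm 3 r)) (proj₁ dm))))
                   (refl , refl)
  where
  dm = divMod-unique 2 r 3 (s≤s (s≤s (s≤s z≤n)))

label₂< : ∀ r j → r < 2 ^ j → label₂ r < width (suc j)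
label₂< r j r< = ≤-trans (≤-reflexive (3+3r≡3[1+r] r)) (*-monoʳ-≤ 3 r<)
  where
  3+3r≡3[1+r] : ∀ r → 3 + 3 * r ≡ 3 * suc r
  3+3r≡3[1+r] = solve-∀

*-%2≡0 : ∀ w a → a % 2 ≡ 0 → (w * a) % 2 ≡ 0
*-%2≡0 w a e = trans (%-distribˡ-* w a 2) (trans (cong (λ z → ((w % 2) * z) % 2) e) (cong (_% 2) (*-zeroʳ (w % 2))))

%2^-double : ∀ j {X Y} → X %2^ j ≡ Y %2^ j → (2 * X) %2^ suc j ≡ (2 * Y) %2^ suc j
%2^-double j {X} {Y} p = begin
  (2 * X) % (2 ^ suc j)       ≡⟨ cong (_% 2 ^ suc j) (*-comm 2 X) ⟩
  (X * 2) % (2 ^ suc j)       ≡⟨ %-congʳ (*-comm 2 (2 ^ j)) ⟩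
  (X * 2) % (2 ^ j * 2)       ≡⟨ %-scale (2 ^ j) 2 {{2^k≢0 j}} p ⟩
  (Y * 2) % (2 ^ j * 2)       ≡⟨ %-congʳ (*-comm 2 (2 ^ j)) ⟨
  (Y * 2) % (2 ^ suc j)       ≡⟨ cong (_% 2 ^ suc j) (*-comm Y 2) ⟩
  (2 * Y) % (2 ^ suc j)       ∎
  where
  open ≡-Reasoning
  instance
    _ = 2^k≢0 (suc j)
    _ = m*n≢0 (2 ^ j) 2 {{2^k≢0 j}}

repXY-%2^ : ∀ c r j → repX c r %2^ suc j ≡ repX c (r %2^ j) %2^ suc j
                    × repY c r %2^ suc j ≡ repY c (r %2^ j) %2^ suc j
repXY-%2^ 0 r j = refl , %2^-double j r≅r%
  where r≅r% = sym (m%n%n≡m%n r (2 ^ j) {{2^k≢0 j}})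
repXY-%2^ 1 r j = refl , Congruence.+-≅ (2 ^ suc j) {{2^k≢0 (suc j)}} {1} refl (%2^-double j r≅r%)
  where r≅r% = sym (m%n%n≡m%n r (2 ^ j) {{2^k≢0 j}})
repXY-%2^ (suc (suc c)) r j = %2^-double j r≅r% , refl
  where r≅r% = sym (m%n%n≡m%n r (2 ^ j) {{2^k≢0 j}})

module Classification (n' : ℕ) where

  open Orbits n' public

  record Represented (j a b : ℕ) : Set where
    field
      level label unit : ℕ
      isNode   : IsNode level label
      odd-unit : Odd unit
      ·≡rep    : mk (scale j * (unit * a)) (scale j * (unit * b)) ≡ rep level label

  represent-odd₁ : ∀ j a b → suc j ≤ n → a % 2 ≡ 1 → Represented (suc j) a b
  represent-odd₁ j a b j<n a-odd = record
    { level = suc j ; label = label₁ t ; unit = w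
    ; isNode = j<n , label₁< t j (m%n<n (w * b) (2 ^ suc j) {{2^k≢0 (suc j)}})
    ; odd-unit = odd-inv n (s≤s z≤n) (%2≡1⇒odd a-odd)
    ; ·≡rep = mk-cong first second }
    where
    w = inv n a
    t = (w * b) %2^ suc j
    first : scale (suc j) * (w * a) ≅ scale (suc j) * repX (label₁ t % 3) (label₁ t / 3)
    first = trans (%2^-scale j<n (%2^-reduce j<n (inv-inverseˡ n (%2≡1⇒odd a-odd))))
                  (cong (λ z → (scale (suc j) * z) % 2 ^ n) (sym (proj₁ (repXY-label₁ t))))
    second : scale (suc j) * (w * b) ≅ scale (suc j) * repY (label₁ t % 3) (label₁ t / 3)
    second = trans (%2^-scale j<n (sym (m%n%n≡m%n (w * b) (2 ^ suc j) {{2^k≢0 (suc j)}})))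
                   (cong (λ z → (scale (suc j) * z) % 2 ^ n) (sym (proj₂ (repXY-label₁ t))))

  represent-odd₂ : ∀ j a b → suc j ≤ n → a % 2 ≡ 0 → b % 2 ≡ 1 → Represented (suc j) a b
  represent-odd₂ j a b j<n a-even b-odd = record
    { level = suc j ; label = label₂ r ; unit = w
    ; isNode = j<n , label₂< r j r<
    ; odd-unit = odd-inv n (s≤s z≤n) (%2≡1⇒odd b-odd)
    ; ·≡rep = mk-cong first second }
    where
    w = inv n b
    t = (w * a) %2^ suc j
    r = t / 2
    t-even : t % 2 ≡ 0
    t-even = trans (m∣n⇒o%n%m≡o%m 2 (2 ^ suc j) (w * a) {{_}} {{2^k≢0 (suc j)}} (m∣m*n (2 ^ j))) (*-%2≡0 w a a-even)
    2r≡t : 2 * r ≡ t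
    2r≡t = sym (trans (m≡m%n+[m/n]*n t 2) (trans (cong (_+ r * 2) t-even) (*-comm r 2)))
    r< : r < 2 ^ j
    r< = m<n*o⇒m/o<n (subst (t <_) (*-comm 2 (2 ^ j)) (m%n<n (w * a) (2 ^ suc j) {{2^k≢0 (suc j)}}))
    first : scale (suc j) * (w * a) ≅ scale (suc j) * repX (label₂ r % 3) (label₂ r / 3)
    first = trans (%2^-scale j<n (sym (m%n%n≡m%n (w * a) (2 ^ suc j) {{2^k≢0 (suc j)}})))
                  (cong (λ z → (scale (suc j) * z) % 2 ^ n) (sym (trans (proj₁ (repXY-label₂ r)) 2r≡t)))
    second : scale (suc j) * (w * b) ≅ scale (suc j) * repY (label₂ r % 3) (label₂ r / 3)
    second = trans (%2^-scale j<n (%2^-reduce j<n (inv-inverseˡ n (%2≡1⇒odd b-odd))))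
                   (cong (λ z → (scale (suc j) * z) % 2 ^ n) (sym (proj₂ (repXY-label₂ r))))

  -- Halving both coordinates and doubling the scale leaves the element unchanged.
  represent-even : ∀ j a b → suc j ≤ n → a % 2 ≡ 0 → b % 2 ≡ 0 →
                   Represented j (a / 2) (b / 2) → Represented (suc j) a b
  represent-even j a b j<n a-even b-even R = record
    { level = level ; label = label ; unit = unit ; isNode = isNode ; odd-unit = odd-unit
    ; ·≡rep = trans (cong₂ mk (halve a a-even) (halve b b-even)) ·≡rep }
    where
    open Represented R
    regroup : ∀ S u x → S * (u * (0 + x * 2)) ≡ 2 * S * (u * x)
    regroup = solve-∀
    halve : ∀ x → x % 2 ≡ 0 → scale (suc j) * (unit * x) ≡ scale j * (unit * (x / 2))
    halve x e = begin
      scale (suc j) * (unit * x)                  ≡⟨ cong (λ z → scale (suc j) * (unit * z)) (m≡m%n+[m/n]*n x 2) ⟩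
      scale (suc j) * (unit * (x % 2 + x / 2 * 2)) ≡⟨ cong (λ z → scale (suc j) * (unit * (z + x / 2 * 2))) e ⟩
      scale (suc j) * (unit * (0 + x / 2 * 2))    ≡⟨ regroup (scale (suc j)) unit (x / 2) ⟩
      2 * scale (suc j) * (unit * (x / 2))        ≡⟨ cong (λ z → 2 ^ z * (unit * (x / 2))) (m∸n≡1+[m∸1+n] j<n) ⟨
      scale j * (unit * (x / 2))                  ∎
      where open ≡-Reasoning

  represent : ∀ j → j ≤ n → ∀ a b → a < 2 ^ j → b < 2 ^ j → Represented j a b
  represent zero _ zero zero _ _ = record
    { level = 0 ; label = 0 ; unit = 1 ; isNode = z≤n , s≤s z≤n ; odd-unit = 0 , refl
    ; ·≡rep = cong₂ mk (*-zeroʳ (2 ^ n)) (*-zeroʳ (2 ^ n)) }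
  represent zero _ (suc a) _       (s≤s ()) _
  represent zero _ zero    (suc b) _        (s≤s ())
  represent (suc j) j<n a b a< b< with %2-cases a | %2-cases b
  ... | inj₂ a-odd  | _          = represent-odd₁ j a b j<n a-odd
  ... | inj₁ a-even | inj₂ b-odd = represent-odd₂ j a b j<n a-even b-odd
  ... | inj₁ a-even | inj₁ b-even =
    represent-even j a b j<n a-even b-even (represent j (<⇒≤ j<n) (a / 2) (b / 2) (half< a<) (half< b<))
    where
    half< : ∀ {x} → x < 2 ^ suc j → x / 2 < 2 ^ j
    half< {x} p = m<n*o⇒m/o<n (subst (x <_) (*-comm 2 (2 ^ j)) p)

  representation : (x : G n) → Represented n (c₁ x) (c₂ x)
  representation x = represent n ≤-refl (c₁ x) (c₂ x) (c₁< x) (c₂< x)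

  level label : G n → ℕ
  level x = Represented.level (representation x)
  label x = Represented.label (representation x)

  isNode : ∀ x → IsNode (level x) (label x)
  isNode x = Represented.isNode (representation x)

  ∼-rep : ∀ x → x ∼ rep (level x) (label x)
  ∼-rep x = ∼-intro x _ odd-unit (sym (trans (cong₂ mk (unscaled (c₁ x)) (unscaled (c₂ x))) ·≡rep))
    where
    open Represented (representation x)
    unscaled : ∀ a → unit * a ≡ scale n * (unit * a)
    unscaled a = trans (sym (*-identityˡ (unit * a))) (cong (λ z → 2 ^ z * (unit * a)) (sym (n∸n≡0 n)))

  node-∼ : ∀ {x y} → x ∼ y → level x ≡ level y × label x ≡ label y
  node-∼ {x} {y} p = rep-∼-injective (isNode x) (isNode y) (∼-trans (∼-sym (∼-rep x)) (∼-trans p (∼-rep y)))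

  node-rep : ∀ {i ℓ} → IsNode i ℓ → level (rep i ℓ) ≡ i × label (rep i ℓ) ≡ ℓ
  node-rep {i} {ℓ} v = rep-∼-injective (isNode (rep i ℓ)) v (∼-sym (∼-rep (rep i ℓ)))

  parent-rep-one : ∀ ℓ → 1 ≤ n → parent (rep 1 ℓ) ≡ rep 0 (ℓ %width 0)
  parent-rep-one ℓ 1≤n = trans (⊕-mk _ _ _ _) (mk-cong (killed (repX (ℓ % 3) (ℓ / 3))) (killed (repY (ℓ % 3) (ℓ / 3))))
    where
    regroup : ∀ S X → S * X + S * X ≡ X * (S * 2)
    regroup = solve-∀
    killed : ∀ X → scale 1 * X + scale 1 * X ≅ 0
    killed X = trans (cong (_% 2 ^ n) (trans (regroup (scale 1) X) (cong (X *_) (2^[n∸i]*2^i≡2^n {1} {n} 1≤n)))) (*d≅0 X)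

  -- The label of the parent is read off from the digits: ℓ % 3 is kept and ℓ / 3 is reduced modulo 2^j.
  parent-rep-suc : ∀ j ℓ → suc (suc j) ≤ n → parent (rep (suc (suc j)) ℓ) ≡ rep (suc j) (ℓ %width suc j)
  parent-rep-suc j ℓ j+2≤n = begin
    parent (rep (suc (suc j)) ℓ)                            ≡⟨ ⊕-mk (S * repX c r) (S * repY c r) _ _ ⟩
    mk (S * repX c r + S * repX c r) (S * repY c r + S * repY c r)
                                                            ≡⟨ cong₂ mk (double (repX c r)) (double (repY c r)) ⟩
    mk (S' * repX c r) (S' * repY c r)
                                                            ≡⟨ mk-cong (reduce (proj₁ (repXY-%2^ c r j)))
                                                                       (reduce (proj₂ (repXY-%2^ c r j))) ⟩
    mk (S' * repX c (r %2^ j)) (S' * repY c (r %2^ j))      ≡⟨ cong₂ repAt' c≡ r≡ ⟨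
    rep (suc j) (ℓ %width suc j)                            ∎
    where
    open ≡-Reasoning
    instance
      _ = width≢0 (suc j)
      _ = 2^k≢0 j
      _ = m*n≢0 (2 ^ j) 3 {{2^k≢0 j}} {{_}}
    c = ℓ % 3
    r = ℓ / 3
    S = scale (suc (suc j))
    S' = scale (suc j)
    repAt' : ℕ → ℕ → G n
    repAt' = repAt (suc j)
    c≡ : (ℓ %width suc j) % 3 ≡ c
    c≡ = m∣n⇒o%n%m≡o%m 3 (3 * 2 ^ j) ℓ {{_}} {{width≢0 (suc j)}} (m∣m*n (2 ^ j))
    r≡ : (ℓ %width suc j) / 3 ≡ r %2^ j
    r≡ = trans (cong (_/ 3) (%-congʳ (*-comm 3 (2 ^ j)))) (m%[n*o]/o≡m/o%n ℓ (2 ^ j) 3)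
    regroup : ∀ S X → S * X + S * X ≡ 2 * S * X
    regroup = solve-∀
    double : ∀ X → S * X + S * X ≡ S' * X
    double X = trans (regroup S X) (cong (λ z → 2 ^ z * X) (sym (m∸n≡1+[m∸1+n] j+2≤n)))
    reduce : ∀ {X Y} → X %2^ suc j ≡ Y %2^ suc j → S' * X ≅ S' * Y
    reduce = %2^-scale (<⇒≤ j+2≤n)

  parent-rep : ∀ i ℓ → IsNode i ℓ → parent (rep i ℓ) ≡ rep (i ∸ 1) (ℓ %width (i ∸ 1))
  parent-rep zero          ℓ _         = ⊕-mk 0 0 0 0
  parent-rep (suc zero)    ℓ (i≤n , _) = parent-rep-one ℓ i≤n
  parent-rep (suc (suc j)) ℓ (i≤n , _) = parent-rep-suc j ℓ i≤n

  node-parent : ∀ x → level (parent x) ≡ level x ∸ 1 × label (parent x) ≡ label x %width (level x ∸ 1)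
  node-parent x = trans (proj₁ p∼) (proj₁ rep-node) , trans (proj₂ p∼) (proj₂ rep-node)
    where
    i = level x ∸ 1
    p∼ = node-∼ (∼-trans (parent-∼ (∼-rep x)) (≡⇒∼ (parent-rep (level x) (label x) (isNode x))))
    rep-node = node-rep {i} {label x %width i}
                 (≤-trans (m∸n≤m (level x) 1) (proj₁ (isNode x)) , m%n<n (label x) (width i) {{width≢0 i}})

-- Cardinalities

HasCard-≡ : ∀ {A R k k'} → k ≡ k' → HasCard A R k → HasCard A R k'
HasCard-≡ refl h = h

HasCard-transport : ∀ {A B : Set} {RA : A → A → Set} {RB : B → B → Set} {k} →
  (F : A → B) (H : B → A) →
  (∀ b b' → RB b b' → RA (H b) (H b')) →
  (∀ a a' → RA a a' → RB (F a) (F a')) →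
  (∀ b → RB (F (H b)) b) →
  (∀ a → RA (H (F a)) a) →
  (∀ {x y z} → RB x y → RB y z → RB x z) →
  HasCard A RA k → HasCard B RB k
HasCard-transport F H H-resp F-resp FH HF RB-trans (to , from , from-to , to-from , from-resp) =
  (λ i → F (to i)) , (λ b → from (H b)) ,
  (λ i → trans (from-resp _ _ (HF (to i))) (from-to i)) ,
  (λ b → RB-trans (F-resp _ _ (to-from (H b))) (FH b)) ,
  (λ b b' p → from-resp _ _ (H-resp b b' p))

×-HasCard : ∀ {A B : Set} {RA : A → A → Set} {RB : B → B → Set} {k m} →
  HasCard A RA k → HasCard B RB m → HasCard (A × B) (×-Pointwise RA RB) (k * m)
×-HasCard {RA = RA} {RB} {k} {m} (toA , fromA , ftA , tfA , frA) (toB , fromB , ftB , tfB , frB) =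
  (λ i → let (a , b) = remQuot {k} m i in toA a , toB b) ,
  (λ x → combine (fromA (proj₁ x)) (fromB (proj₂ x))) ,
  (λ i → trans (cong₂ combine (ftA _) (ftB _)) (combine-remQuot {k} m i)) ,
  (λ x → subst (λ ij → ×-Pointwise RA RB (toA (proj₁ ij) , toB (proj₂ ij)) x)
                (sym (remQuot-combine (fromA (proj₁ x)) (fromB (proj₂ x))))
                (tfA (proj₁ x) , tfB (proj₂ x))) ,
  (λ x y p → cong₂ combine (frA _ _ (proj₁ p)) (frB _ _ (proj₂ p)))

⊎-HasCard : ∀ {A B : Set} {RA : A → A → Set} {RB : B → B → Set} {k m} →
  HasCard A RA k → HasCard B RB m → HasCard (A ⊎ B) (⊎-Pointwise RA RB) (k + m)
⊎-HasCard {A} {B} {RA} {RB} {k} {m} (toA , fromA , ftA , tfA , frA) (toB , fromB , ftB , tfB , frB) =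
  (λ i → to (splitAt k i)) , from , from-to , to-from , from-resp
  where
  to : Fin k ⊎ Fin m → A ⊎ B
  to (inj₁ i) = inj₁ (toA i)
  to (inj₂ j) = inj₂ (toB j)
  from′ : A ⊎ B → Fin k ⊎ Fin m
  from′ (inj₁ a) = inj₁ (fromA a)
  from′ (inj₂ b) = inj₂ (fromB b)
  from : A ⊎ B → Fin (k + m)
  from x = join k m (from′ x)
  from′-to : ∀ z → from′ (to z) ≡ z
  from′-to (inj₁ i) = cong inj₁ (ftA i)
  from′-to (inj₂ j) = cong inj₂ (ftB j)
  from-to : ∀ i → from (to (splitAt k i)) ≡ i
  from-to i = trans (cong (join k m) (from′-to (splitAt k i))) (join-splitAt k m i)
  to-from′ : ∀ x → ⊎-Pointwise RA RB (to (from′ x)) x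
  to-from′ (inj₁ a) = inj₁ (tfA a)
  to-from′ (inj₂ b) = inj₂ (tfB b)
  to-from : ∀ x → ⊎-Pointwise RA RB (to (splitAt k (from x))) x
  to-from x = subst (λ z → ⊎-Pointwise RA RB (to z) x) (sym (splitAt-join k m (from′ x))) (to-from′ x)
  from-resp : ∀ x y → ⊎-Pointwise RA RB x y → from x ≡ from y
  from-resp _ _ (inj₁ p) = cong (λ z → join k m (inj₁ z)) (frA _ _ p)
  from-resp _ _ (inj₂ p) = cong (λ z → join k m (inj₂ z)) (frB _ _ p)

HasCard-byCode : ∀ {A : Set} {R : A → A → Set} {k} →
  (code : A → ℕ) (decode : ℕ → A) →
  (∀ a → code a < k) →
  (∀ i → i < k → code (decode i) ≡ i) →
  (∀ a → R (decode (code a)) a) →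
  (∀ a a' → R a a' → code a ≡ code a') →
  HasCard A R k
HasCard-byCode {R = R} code decode code< code-decode decode-code code-resp =
  (λ i → decode (toℕ i)) , (λ a → fromℕ< (code< a)) ,
  (λ i → toℕ-injective (trans (toℕ-fromℕ< _) (code-decode (toℕ i) (toℕ<n i)))) ,
  (λ a → subst (λ z → R (decode z) a) (sym (toℕ-fromℕ< (code< a))) (decode-code a)) ,
  (λ a a' p → toℕ-injective (trans (toℕ-fromℕ< _) (trans (code-resp a a' p) (sym (toℕ-fromℕ< _)))))

Below : ℕ → Set
Below m = Σ ℕ (_< m)

_≈Below_ : ∀ {m} → Below m → Below m → Set
x ≈Below y = proj₁ x ≡ proj₁ y

Below-HasCard : ∀ m .{{_ : NonZero m}} → HasCard (Below m) _≈Below_ m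
Below-HasCard m = HasCard-byCode proj₁ (λ i → i % m , m%n<n i m) proj₂
  (λ i i< → m<n⇒m%n≡m i<) (λ x → m<n⇒m%n≡m (proj₂ x)) (λ x y p → p)

Bool-HasCard : HasCard Bool _≡_ 2
Bool-HasCard = HasCard-byCode code decode code< code-decode decode-code (λ _ _ → cong code)
  where
  code : Bool → ℕ
  code false = 0
  code true  = 1
  decode : ℕ → Bool
  decode 0 = false
  decode _ = true
  code< : ∀ b → code b < 2
  code< false = s≤s z≤n
  code< true  = s≤s (s≤s z≤n)
  code-decode : ∀ i → i < 2 → code (decode i) ≡ i
  code-decode 0 _ = refl
  code-decode 1 _ = refl
  code-decode (suc (suc _)) (s≤s (s≤s ()))
  decode-code : ∀ b → decode (code b) ≡ b
  decode-code false = refl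
  decode-code true  = refl

Bits : Set
Bits = ℕ → Bool

_≈Bits[_]_ : Bits → ℕ → Bits → Set
β ≈Bits[ m ] β' = ∀ i → i < m → β i ≡ β' i

Bits-HasCard : ∀ m → HasCard Bits (λ β β' → β ≈Bits[ m ] β') (2 ^ m)
Bits-HasCard zero =
  (λ _ _ → false) , (λ _ → Fin.zero) , (λ { Fin.zero → refl }) , (λ β i ()) , (λ _ _ _ → refl)
  where import Data.Fin as Fin
Bits-HasCard (suc m) = HasCard-transport cons uncons uncons-resp cons-resp cons-uncons uncons-cons
  (λ p q i i< → trans (p i i<) (q i i<)) (×-HasCard Bool-HasCard (Bits-HasCard m))
  where
  cons : Bool × Bits → Bits
  cons (b , β) zero    = b
  cons (b , β) (suc i) = β i
  uncons : Bits → Bool × Bits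
  uncons β = β 0 , (λ i → β (suc i))
  uncons-resp : ∀ β β' → β ≈Bits[ suc m ] β' → ×-Pointwise _≡_ _≈Bits[ m ]_ (uncons β) (uncons β')
  uncons-resp β β' p = p 0 (s≤s z≤n) , (λ i i< → p (suc i) (s≤s i<))
  cons-resp : ∀ x y → ×-Pointwise _≡_ _≈Bits[ m ]_ x y → cons x ≈Bits[ suc m ] cons y
  cons-resp x y (p , q) zero    _       = p
  cons-resp x y (p , q) (suc i) (s≤s i<) = q i i<
  cons-uncons : ∀ β → cons (uncons β) ≈Bits[ suc m ] β
  cons-uncons β zero    _ = refl
  cons-uncons β (suc i) _ = refl
  uncons-cons : ∀ x → ×-Pointwise _≡_ _≈Bits[ m ]_ (uncons (cons x)) x
  uncons-cons x = refl , (λ i _ → refl)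

-- Automorphisms of the orbit tree

-- Automorphisms of the first d levels of the tree of labels, whose parent map is
-- ℓ ↦ ℓ %width (i ∸ 1) at level i; for d = n this is the orbit tree.
record LabelAut (d : ℕ) : Set where
  field
    f g  : ℕ → ℕ → ℕ
    f<   : ∀ {i ℓ} → i ≤ d → ℓ < width i → f i ℓ < width i
    g<   : ∀ {i ℓ} → i ≤ d → ℓ < width i → g i ℓ < width i
    g∘f  : ∀ {i ℓ} → i ≤ d → ℓ < width i → g i (f i ℓ) ≡ ℓ
    f∘g  : ∀ {i ℓ} → i ≤ d → ℓ < width i → f i (g i ℓ) ≡ ℓ
    f-%  : ∀ {i ℓ} → suc i ≤ d → ℓ < width (suc i) → f i (ℓ %width i) ≡ f (suc i) ℓ %width i

open LabelAut

_≈L_ : ∀ {d} → LabelAut d → LabelAut d → Set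
_≈L_ {d} a b = ∀ i ℓ → i ≤ d → ℓ < width i → f a i ℓ ≡ f b i ℓ

≈L-trans : ∀ {d} {a b c : LabelAut d} → a ≈L b → b ≈L c → a ≈L c
≈L-trans p q i ℓ i≤ ℓ< = trans (p i ℓ i≤ ℓ<) (q i ℓ i≤ ℓ<)

f-injective : ∀ {d} (a : LabelAut d) {i x y} → i ≤ d → x < width i → y < width i → f a i x ≡ f a i y → x ≡ y
f-injective a i≤ x< y< e = trans (sym (g∘f a i≤ x<)) (trans (cong (g a _) e) (g∘f a i≤ y<))

-- The six permutations of {0, 1, 2}; perm k is determined by its values at 0 and 1.
perm : ℕ → ℕ → ℕ
perm 0 ℓ = ℓ
perm 1 0 = 0
perm 1 1 = 2
perm 1 2 = 1
perm 2 0 = 1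
perm 2 1 = 0
perm 2 2 = 2
perm 3 0 = 1
perm 3 1 = 2
perm 3 2 = 0
perm 4 0 = 2
perm 4 1 = 0
perm 4 2 = 1
perm 5 0 = 2
perm 5 1 = 1
perm 5 2 = 0
perm _ ℓ = ℓ

perm⁻¹ : ℕ → ℕ
perm⁻¹ 3 = 4
perm⁻¹ 4 = 3
perm⁻¹ k = k

permCode : ℕ → ℕ → ℕ
permCode 0 1 = 0
permCode 0 2 = 1
permCode 1 0 = 2
permCode 1 2 = 3
permCode 2 0 = 4
permCode 2 1 = 5
permCode _ _ = 0

permCode<6 : ∀ x y → permCode x y < 6
permCode<6 0 0 = s≤s z≤n
permCode<6 0 1 = s≤s z≤n
permCode<6 0 2 = s≤s (s≤s z≤n)
permCode<6 0 (suc (suc (suc y))) = s≤s z≤n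
permCode<6 1 0 = s≤s (s≤s (s≤s z≤n))
permCode<6 1 1 = s≤s z≤n
permCode<6 1 2 = s≤s (s≤s (s≤s (s≤s z≤n)))
permCode<6 1 (suc (suc (suc y))) = s≤s z≤n
permCode<6 2 0 = s≤s (s≤s (s≤s (s≤s (s≤s z≤n))))
permCode<6 2 1 = s≤s (s≤s (s≤s (s≤s (s≤s (s≤s z≤n)))))
permCode<6 2 (suc (suc y)) = s≤s z≤n
permCode<6 (suc (suc (suc x))) y = s≤s z≤n

perm<3 : ∀ k ℓ → k < 6 → ℓ < 3 → perm k ℓ < 3
perm<3 0 ℓ _ p = p
perm<3 1 0 _ _ = s≤s z≤n
perm<3 1 1 _ _ = s≤s (s≤s (s≤s z≤n))
perm<3 1 2 _ _ = s≤s (s≤s z≤n)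
perm<3 2 0 _ _ = s≤s (s≤s z≤n)
perm<3 2 1 _ _ = s≤s z≤n
perm<3 2 2 _ _ = s≤s (s≤s (s≤s z≤n))
perm<3 3 0 _ _ = s≤s (s≤s z≤n)
perm<3 3 1 _ _ = s≤s (s≤s (s≤s z≤n))
perm<3 3 2 _ _ = s≤s z≤n
perm<3 4 0 _ _ = s≤s (s≤s (s≤s z≤n))
perm<3 4 1 _ _ = s≤s z≤n
perm<3 4 2 _ _ = s≤s (s≤s z≤n)
perm<3 5 0 _ _ = s≤s (s≤s (s≤s z≤n))
perm<3 5 1 _ _ = s≤s (s≤s z≤n)
perm<3 5 2 _ _ = s≤s z≤n
perm<3 (suc (suc (suc (suc (suc (suc _)))))) _ (s≤s (s≤s (s≤s (s≤s (s≤s (s≤s ())))))) _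
perm<3 (suc _) (suc (suc (suc _))) _ (s≤s (s≤s (s≤s ())))

perm⁻¹<6 : ∀ k → k < 6 → perm⁻¹ k < 6
perm⁻¹<6 0 p = p
perm⁻¹<6 1 p = p
perm⁻¹<6 2 p = p
perm⁻¹<6 3 p = s≤s (s≤s (s≤s (s≤s (s≤s z≤n))))
perm⁻¹<6 4 p = s≤s (s≤s (s≤s (s≤s z≤n)))
perm⁻¹<6 (suc (suc (suc (suc (suc k))))) p = p

perm-inverse : ∀ k ℓ → k < 6 → ℓ < 3 → perm (perm⁻¹ k) (perm k ℓ) ≡ ℓ × perm k (perm (perm⁻¹ k) ℓ) ≡ ℓ
perm-inverse 0 ℓ _ _ = refl , refl
perm-inverse 1 0 _ _ = refl , refl
perm-inverse 1 1 _ _ = refl , refl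
perm-inverse 1 2 _ _ = refl , refl
perm-inverse 2 0 _ _ = refl , refl
perm-inverse 2 1 _ _ = refl , refl
perm-inverse 2 2 _ _ = refl , refl
perm-inverse 3 0 _ _ = refl , refl
perm-inverse 3 1 _ _ = refl , refl
perm-inverse 3 2 _ _ = refl , refl
perm-inverse 4 0 _ _ = refl , refl
perm-inverse 4 1 _ _ = refl , refl
perm-inverse 4 2 _ _ = refl , refl
perm-inverse 5 0 _ _ = refl , refl
perm-inverse 5 1 _ _ = refl , refl
perm-inverse 5 2 _ _ = refl , refl
perm-inverse (suc (suc (suc (suc (suc (suc _)))))) _ (s≤s (s≤s (s≤s (s≤s (s≤s (s≤s ())))))) _
perm-inverse (suc _) (suc (suc (suc _))) _ (s≤s (s≤s (s≤s ())))

permCode-perm : ∀ k → k < 6 → permCode (perm k 0) (perm k 1) ≡ k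
permCode-perm 0 _ = refl
permCode-perm 1 _ = refl
permCode-perm 2 _ = refl
permCode-perm 3 _ = refl
permCode-perm 4 _ = refl
permCode-perm 5 _ = refl
permCode-perm (suc (suc (suc (suc (suc (suc _)))))) (s≤s (s≤s (s≤s (s≤s (s≤s (s≤s ()))))))

perm-permCode : ∀ x₀ x₁ x₂ → x₀ < 3 → x₁ < 3 → x₂ < 3 → x₀ ≢ x₁ → x₀ ≢ x₂ → x₁ ≢ x₂ →
  perm (permCode x₀ x₁) 0 ≡ x₀ × perm (permCode x₀ x₁) 1 ≡ x₁ × perm (permCode x₀ x₁) 2 ≡ x₂
perm-permCode 0 0 _ _ _ _ n01 _ _ = contradiction refl n01
perm-permCode 1 1 _ _ _ _ n01 _ _ = contradiction refl n01
perm-permCode 2 2 _ _ _ _ n01 _ _ = contradiction refl n01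
perm-permCode 0 1 2 _ _ _ _ _ _ = refl , refl , refl
perm-permCode 0 2 1 _ _ _ _ _ _ = refl , refl , refl
perm-permCode 1 0 2 _ _ _ _ _ _ = refl , refl , refl
perm-permCode 1 2 0 _ _ _ _ _ _ = refl , refl , refl
perm-permCode 2 0 1 _ _ _ _ _ _ = refl , refl , refl
perm-permCode 2 1 0 _ _ _ _ _ _ = refl , refl , refl
perm-permCode 0 _ 0 _ _ _ _ n02 _ = contradiction refl n02
perm-permCode 1 _ 1 _ _ _ _ n02 _ = contradiction refl n02
perm-permCode 2 _ 2 _ _ _ _ n02 _ = contradiction refl n02
perm-permCode _ 0 0 _ _ _ _ _ n12 = contradiction refl n12
perm-permCode _ 1 1 _ _ _ _ _ n12 = contradiction refl n12
perm-permCode _ 2 2 _ _ _ _ _ n12 = contradiction refl n12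
perm-permCode (suc (suc (suc _))) _ _ (s≤s (s≤s (s≤s ()))) _ _ _ _ _
perm-permCode _ (suc (suc (suc _))) _ _ (s≤s (s≤s (s≤s ()))) _ _ _ _
perm-permCode _ _ (suc (suc (suc _))) _ _ (s≤s (s≤s (s≤s ()))) _ _ _

permAut : ℕ → LabelAut 1
permAut k = record { f = F ; g = F⁻¹ ; f< = F< ; g< = F⁻¹< ; g∘f = F⁻¹∘F ; f∘g = F∘F⁻¹ ; f-% = F-% }
  where
  k′ = k % 6
  k′<6 : k′ < 6
  k′<6 = m%n<n k 6
  F F⁻¹ : ℕ → ℕ → ℕ
  F (suc zero) ℓ = perm k′ ℓ
  F _          ℓ = ℓ
  F⁻¹ (suc zero) ℓ = perm (perm⁻¹ k′) ℓ
  F⁻¹ _          ℓ = ℓ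
  F< : ∀ {i ℓ} → i ≤ 1 → ℓ < width i → F i ℓ < width i
  F< {zero}        _ p = p
  F< {suc zero}    _ p = perm<3 k′ _ k′<6 p
  F< {suc (suc _)} (s≤s ()) _
  F⁻¹< : ∀ {i ℓ} → i ≤ 1 → ℓ < width i → F⁻¹ i ℓ < width i
  F⁻¹< {zero}        _ p = p
  F⁻¹< {suc zero}    _ p = perm<3 (perm⁻¹ k′) _ (perm⁻¹<6 k′ k′<6) p
  F⁻¹< {suc (suc _)} (s≤s ()) _
  F⁻¹∘F : ∀ {i ℓ} → i ≤ 1 → ℓ < width i → F⁻¹ i (F i ℓ) ≡ ℓ
  F⁻¹∘F {zero}        _ _ = refl
  F⁻¹∘F {suc zero}    _ p = proj₁ (perm-inverse k′ _ k′<6 p)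
  F⁻¹∘F {suc (suc _)} (s≤s ()) _
  F∘F⁻¹ : ∀ {i ℓ} → i ≤ 1 → ℓ < width i → F i (F⁻¹ i ℓ) ≡ ℓ
  F∘F⁻¹ {zero}        _ _ = refl
  F∘F⁻¹ {suc zero}    _ p = proj₂ (perm-inverse k′ _ k′<6 p)
  F∘F⁻¹ {suc (suc _)} (s≤s ()) _
  F-% : ∀ {i ℓ} → suc i ≤ 1 → ℓ < width (suc i) → F i (ℓ %width i) ≡ F (suc i) ℓ %width i
  F-% {zero} {ℓ} _ _ = trans (n%1≡0 ℓ) (sym (n%1≡0 (perm k′ ℓ)))
  F-% {suc _} (s≤s ()) _

LabelAut1-HasCard : HasCard (LabelAut 1) _≈L_ 6
LabelAut1-HasCard = HasCard-byCode code permAut (λ a → permCode<6 _ _) code-permAut permAut-code code-resp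
  where
  code : LabelAut 1 → ℕ
  code a = permCode (f a 1 0) (f a 1 1)
  code-permAut : ∀ k → k < 6 → code (permAut k) ≡ k
  code-permAut k k< rewrite m<n⇒m%n≡m k< = permCode-perm k k<
  code-resp : ∀ a a' → a ≈L a' → code a ≡ code a'
  code-resp a a' p = cong₂ permCode (p 1 0 ≤-refl (s≤s z≤n)) (p 1 1 ≤-refl (s≤s (s≤s z≤n)))
  permAut-code : ∀ a → permAut (code a) ≈L a
  permAut-code a zero zero _ _ = sym (n<1⇒n≡0 (f< a z≤n (s≤s z≤n)))
  permAut-code a zero (suc ℓ) _ (s≤s ())
  permAut-code a (suc (suc _)) _ (s≤s ()) _
  permAut-code a (suc zero) ℓ _ ℓ< rewrite m<n⇒m%n≡m (permCode<6 (f a 1 0) (f a 1 1)) = values ℓ ℓ<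
    where
    0<3 : 0 < 3
    0<3 = s≤s z≤n
    1<3 : 1 < 3
    1<3 = s≤s (s≤s z≤n)
    2<3 : 2 < 3
    2<3 = s≤s (s≤s (s≤s z≤n))
    distinct : ∀ {x y} → x < 3 → y < 3 → x ≢ y → f a 1 x ≢ f a 1 y
    distinct xp yp x≢y e = x≢y (f-injective a ≤-refl xp yp e)
    p = perm-permCode (f a 1 0) (f a 1 1) (f a 1 2) (f< a ≤-refl 0<3) (f< a ≤-refl 1<3) (f< a ≤-refl 2<3)
          (distinct 0<3 1<3 (λ ())) (distinct 0<3 2<3 (λ ())) (distinct 1<3 2<3 (λ ()))
    values : ∀ ℓ → ℓ < 3 → perm (permCode (f a 1 0) (f a 1 1)) ℓ ≡ f a 1 ℓ
    values 0 _ = proj₁ p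
    values 1 _ = proj₁ (proj₂ p)
    values 2 _ = proj₂ (proj₂ p)
    values (suc (suc (suc _))) (s≤s (s≤s (s≤s ())))

≤suc⇒≡∨≤ : ∀ {i P} → i ≤ suc P → (i ≡ suc P) ⊎ (i ≤ P)
≤suc⇒≡∨≤ p with m≤n⇒m<n∨m≡n p
... | inj₁ (s≤s q) = inj₂ q
... | inj₂ e       = inj₁ e

bit : Bool → ℕ
bit false = 0
bit true  = 1

xor-cancelʳ : ∀ a b → (a xor b) xor b ≡ a
xor-cancelʳ a b = trans (xor-assoc a b b) (trans (cong (a xor_) (xor-same b)) (xor-identityʳ a))

-- The labels at level d+2 are  child q b  for q a label at level d+1 and a bit b.
-- An automorphism of depth d+2 is one of depth d+1 together with, for each label q at
-- level d+1, a bit saying whether the two children of q are swapped.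
module Extension (d : ℕ) where

  private
    P = suc d
    S = width P
    instance S≢0 = width≢0 P

  width-suc : width (suc P) ≡ 2 * S
  width-suc = regroup (2 ^ d)
    where
    regroup : ∀ x → 3 * (2 * x) ≡ 2 * (3 * x)
    regroup = solve-∀

  S≤width-suc : S ≤ width (suc P)
  S≤width-suc = subst (S ≤_) (sym width-suc) (m≤m+n S (S + 0))

  upper : ℕ → Bool
  upper ℓ with S ≤? ℓ
  ... | yes _ = true
  ... | no _  = false

  upper-< : ∀ {ℓ} → ℓ < S → upper ℓ ≡ false
  upper-< {ℓ} p with S ≤? ℓ
  ... | yes q = ⊥-elim (<⇒≱ p q)
  ... | no _  = refl

  upper-≥ : ∀ {ℓ} → S ≤ ℓ → upper ℓ ≡ true
  upper-≥ {ℓ} p with S ≤? ℓ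
  ... | yes _ = refl
  ... | no q  = ⊥-elim (q p)

  child : ℕ → Bool → ℕ
  child q b = q + bit b * S

  child-% : ∀ {q} b → q < S → child q b % S ≡ q
  child-% {q} b p = trans ([m+kn]%n≡m%n q (bit b) S) (m<n⇒m%n≡m p)

  upper-child : ∀ {q} b → q < S → upper (child q b) ≡ b
  upper-child {q} false p = trans (cong upper (+-identityʳ q)) (upper-< p)
  upper-child {q} true  p = upper-≥ (≤-trans (m≤m+n S 0) (m≤n+m (S + 0) q))

  child< : ∀ {q} b → q < S → child q b < width (suc P)
  child< {q} false p = subst (_< width (suc P)) (sym (+-identityʳ q)) (≤-trans p S≤width-suc)
  child< {q} true  p = subst (child q true <_) (sym width-suc) (+-monoˡ-< (S + 0) p)

  child-upper : ∀ {ℓ} → ℓ < width (suc P) → child (ℓ % S) (upper ℓ) ≡ ℓ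
  child-upper {ℓ} p with S ≤? ℓ
  ... | no q  = trans (+-identityʳ _) (m<n⇒m%n≡m (≰⇒> q))
  ... | yes q = trans (cong (ℓ % S +_) (+-identityʳ S)) (trans (cong (_+ S) ℓ%S≡ℓ∸S) (m∸n+n≡m q))
    where
    ℓ∸S<S : ℓ ∸ S < S
    ℓ∸S<S = subst (ℓ ∸ S <_) (m+n∸m≡n S S)
              (∸-monoˡ-< (subst (ℓ <_) (trans width-suc (cong (S +_) (+-identityʳ S))) p) q)
    ℓ%S≡ℓ∸S : ℓ % S ≡ ℓ ∸ S
    ℓ%S≡ℓ∸S = trans (sym (m≤n⇒[n∸m]%m≡n%m q)) (m<n⇒m%n≡m ℓ∸S<S)

  withTop : (ℕ → ℕ → ℕ) → (ℕ → ℕ) → ℕ → ℕ → ℕ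
  withTop h F i ℓ with i ≟ suc P
  ... | yes _ = F ℓ
  ... | no _  = h i ℓ

  withTop-top : ∀ h F ℓ → withTop h F (suc P) ℓ ≡ F ℓ
  withTop-top h F ℓ with suc P ≟ suc P
  ... | yes _ = refl
  ... | no ne = ⊥-elim (ne refl)

  withTop-below : ∀ h F {i} ℓ → i ≤ P → withTop h F i ℓ ≡ h i ℓ
  withTop-below h F {i} ℓ p with i ≟ suc P
  ... | yes refl = ⊥-elim (1+n≰n p)
  ... | no _     = refl

  %S<S : ∀ ℓ → ℓ % S < S
  %S<S ℓ = m%n<n ℓ S

  <S⇒<width-suc : ∀ {q} → q < S → q < width (suc P)
  <S⇒<width-suc q< = ≤-trans q< S≤width-suc

  restrict : LabelAut (suc P) → LabelAut P
  restrict a = record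
    { f = f a ; g = g a
    ; f< = λ i≤ → f< a (m≤n⇒m≤1+n i≤) ; g< = λ i≤ → g< a (m≤n⇒m≤1+n i≤)
    ; g∘f = λ i≤ → g∘f a (m≤n⇒m≤1+n i≤) ; f∘g = λ i≤ → f∘g a (m≤n⇒m≤1+n i≤)
    ; f-% = λ i≤ → f-% a (m≤n⇒m≤1+n i≤) }

  twists : LabelAut (suc P) → Bits
  twists a q = upper (f a (suc P) q)

  module _ (a : LabelAut P) (β : Bits) where

    fBit gBit : ℕ → Bool
    fBit ℓ = upper ℓ xor β (ℓ % S)
    gBit ℓ = upper ℓ xor β (g a P (ℓ % S))

    fTop gTop : ℕ → ℕ
    fTop ℓ = child (f a P (ℓ % S)) (fBit ℓ)
    gTop ℓ = child (g a P (ℓ % S)) (gBit ℓ)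

    private
      fP< : ∀ ℓ → f a P (ℓ % S) < S
      fP< ℓ = f< a ≤-refl (%S<S ℓ)
      gP< : ∀ ℓ → g a P (ℓ % S) < S
      gP< ℓ = g< a ≤-refl (%S<S ℓ)

    gTop∘fTop : ∀ ℓ → ℓ < width (suc P) → gTop (fTop ℓ) ≡ ℓ
    gTop∘fTop ℓ ℓ< = begin
      child (g a P (fTop ℓ % S)) (upper (fTop ℓ) xor β (g a P (fTop ℓ % S)))
        ≡⟨ cong₂ (λ x y → child (g a P x) (y xor β (g a P x))) (child-% (fBit ℓ) (fP< ℓ)) (upper-child (fBit ℓ) (fP< ℓ)) ⟩
      child (g a P (f a P p)) ((upper ℓ xor β p) xor β (g a P (f a P p)))
        ≡⟨ cong (λ x → child x ((upper ℓ xor β p) xor β x)) (g∘f a ≤-refl (%S<S ℓ)) ⟩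
      child p ((upper ℓ xor β p) xor β p)
        ≡⟨ cong (child p) (xor-cancelʳ (upper ℓ) (β p)) ⟩
      child p (upper ℓ)
        ≡⟨ child-upper ℓ< ⟩
      ℓ ∎
      where
      open ≡-Reasoning
      p = ℓ % S

    fTop∘gTop : ∀ ℓ → ℓ < width (suc P) → fTop (gTop ℓ) ≡ ℓ
    fTop∘gTop ℓ ℓ< = begin
      child (f a P (gTop ℓ % S)) (upper (gTop ℓ) xor β (gTop ℓ % S))
        ≡⟨ cong₂ (λ x y → child (f a P x) (y xor β x)) (child-% (gBit ℓ) (gP< ℓ)) (upper-child (gBit ℓ) (gP< ℓ)) ⟩
      child (f a P q) ((upper ℓ xor β q) xor β q)
        ≡⟨ cong₂ child (f∘g a ≤-refl (%S<S ℓ)) (xor-cancelʳ (upper ℓ) (β q)) ⟩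
      child (ℓ % S) (upper ℓ)
        ≡⟨ child-upper ℓ< ⟩
      ℓ ∎
      where
      open ≡-Reasoning
      q = g a P (ℓ % S)

    extend : LabelAut (suc P)
    extend = record
      { f = withTop (f a) fTop ; g = withTop (g a) gTop
      ; f< = F< ; g< = G< ; g∘f = G∘F ; f∘g = F∘G ; f-% = F-% }
      where
      F< : ∀ {i ℓ} → i ≤ suc P → ℓ < width i → withTop (f a) fTop i ℓ < width i
      F< {i} {ℓ} i≤ ℓ< with ≤suc⇒≡∨≤ i≤
      ... | inj₁ refl = subst (_< width (suc P)) (sym (withTop-top (f a) fTop ℓ)) (child< (fBit ℓ) (fP< ℓ))
      ... | inj₂ q    = subst (_< width i) (sym (withTop-below (f a) fTop ℓ q)) (f< a q ℓ<)
      G< : ∀ {i ℓ} → i ≤ suc P → ℓ < width i → withTop (g a) gTop i ℓ < width i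
      G< {i} {ℓ} i≤ ℓ< with ≤suc⇒≡∨≤ i≤
      ... | inj₁ refl = subst (_< width (suc P)) (sym (withTop-top (g a) gTop ℓ)) (child< (gBit ℓ) (gP< ℓ))
      ... | inj₂ q    = subst (_< width i) (sym (withTop-below (g a) gTop ℓ q)) (g< a q ℓ<)
      G∘F : ∀ {i ℓ} → i ≤ suc P → ℓ < width i → withTop (g a) gTop i (withTop (f a) fTop i ℓ) ≡ ℓ
      G∘F {i} {ℓ} i≤ ℓ< with ≤suc⇒≡∨≤ i≤
      ... | inj₁ refl = trans (withTop-top (g a) gTop _) (trans (cong gTop (withTop-top (f a) fTop ℓ)) (gTop∘fTop ℓ ℓ<))
      ... | inj₂ q    = trans (withTop-below (g a) gTop _ q) (trans (cong (g a i) (withTop-below (f a) fTop ℓ q)) (g∘f a q ℓ<))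
      F∘G : ∀ {i ℓ} → i ≤ suc P → ℓ < width i → withTop (f a) fTop i (withTop (g a) gTop i ℓ) ≡ ℓ
      F∘G {i} {ℓ} i≤ ℓ< with ≤suc⇒≡∨≤ i≤
      ... | inj₁ refl = trans (withTop-top (f a) fTop _) (trans (cong fTop (withTop-top (g a) gTop ℓ)) (fTop∘gTop ℓ ℓ<))
      ... | inj₂ q    = trans (withTop-below (f a) fTop _ q) (trans (cong (f a i) (withTop-below (g a) gTop ℓ q)) (f∘g a q ℓ<))
      F-% : ∀ {i ℓ} → suc i ≤ suc P → ℓ < width (suc i) →
            withTop (f a) fTop i (ℓ %width i) ≡ withTop (f a) fTop (suc i) ℓ %width i
      F-% {i} {ℓ} i≤ ℓ< with ≤suc⇒≡∨≤ i≤
      ... | inj₁ refl = trans (withTop-below (f a) fTop (ℓ % S) ≤-refl)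
                              (sym (trans (cong (_% S) (withTop-top (f a) fTop ℓ)) (child-% (fBit ℓ) (fP< ℓ))))
      ... | inj₂ q    = trans (withTop-below (f a) fTop _ (<⇒≤ q))
                              (trans (f-% a q ℓ<) (cong (_%width i) (sym (withTop-below (f a) fTop ℓ q))))

  f-top≡child : ∀ (a : LabelAut (suc P)) ℓ → ℓ < width (suc P) →
                child (f a P (ℓ % S)) (upper ℓ xor upper (f a (suc P) (ℓ % S))) ≡ f a (suc P) ℓ
  f-top≡child a ℓ ℓ< = trans (cong₂ child (f-% a ≤-refl ℓ<) (bits (S ≤? ℓ))) (child-upper (f< a ≤-refl ℓ<))
    where
    p = ℓ % S
    fℓ = f a (suc P) ℓ
    fp = f a (suc P) p
    same-parent : fℓ % S ≡ fp % S
    same-parent = trans (sym (f-% a ≤-refl ℓ<))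
                    (trans (cong (f a P) (sym (m<n⇒m%n≡m (%S<S ℓ)))) (f-% a ≤-refl (<S⇒<width-suc (%S<S ℓ))))
    bits : Dec (S ≤ ℓ) → upper ℓ xor upper fp ≡ upper fℓ
    bits (no ℓ<S)  = trans (cong (_xor upper fp) (upper-< (≰⇒> ℓ<S)))
                           (cong (λ z → upper (f a (suc P) z)) (m<n⇒m%n≡m (≰⇒> ℓ<S)))
    bits (yes S≤ℓ) = trans (cong (_xor upper fp) (upper-≥ S≤ℓ)) (trans (true-xor (upper fp)) (sym (¬-not distinct)))
      where
      distinct : upper fℓ ≢ upper fp
      distinct e = <⇒≱ (%S<S ℓ) (subst (S ≤_) ℓ≡p S≤ℓ)
        where
        ℓ≡p : ℓ ≡ p
        ℓ≡p = f-injective a ≤-refl ℓ< (<S⇒<width-suc (%S<S ℓ))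
                (trans (sym (child-upper (f< a ≤-refl ℓ<)))
                       (trans (cong₂ child same-parent e) (child-upper (f< a ≤-refl (<S⇒<width-suc (%S<S ℓ))))))

  extend-restrict : ∀ a → extend (restrict a) (twists a) ≈L a
  extend-restrict a i ℓ i≤ ℓ< with ≤suc⇒≡∨≤ i≤
  ... | inj₁ refl = trans (withTop-top (f a) _ ℓ) (f-top≡child a ℓ ℓ<)
  ... | inj₂ q    = withTop-below (f a) _ ℓ q

  restrict-extend : ∀ a β → restrict (extend a β) ≈L a
  restrict-extend a β i ℓ i≤ ℓ< = withTop-below (f a) _ ℓ i≤

  twists-extend : ∀ a β → twists (extend a β) ≈Bits[ S ] β
  twists-extend a β q q< =
    trans (cong upper (withTop-top (f a) _ q))
      (trans (upper-child (fBit a β q) (f< a ≤-refl (%S<S q))) (cong₂ (λ x y → x xor β y) (upper-< q<) (m<n⇒m%n≡m q<)))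

  extend-resp : ∀ {a a' β β'} → a ≈L a' → β ≈Bits[ S ] β' → extend a β ≈L extend a' β'
  extend-resp {a} {a'} pa pβ i ℓ i≤ ℓ< with ≤suc⇒≡∨≤ i≤
  ... | inj₁ refl = trans (withTop-top (f a) _ ℓ)
                      (trans (cong₂ child (pa P (ℓ % S) ≤-refl (%S<S ℓ)) (cong (upper ℓ xor_) (pβ (ℓ % S) (%S<S ℓ))))
                             (sym (withTop-top (f a') _ ℓ)))
  ... | inj₂ q    = trans (withTop-below (f a) _ ℓ q) (trans (pa i ℓ q ℓ<) (sym (withTop-below (f a') _ ℓ q)))

  LabelAut-suc-HasCard : ∀ {k} → HasCard (LabelAut P) _≈L_ k → HasCard (LabelAut (suc P)) _≈L_ (k * 2 ^ S)
  LabelAut-suc-HasCard h = HasCard-transport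
    (λ (a , β) → extend a β) (λ a → restrict a , twists a)
    (λ a a' e → (λ i ℓ i≤ ℓ< → e i ℓ (m≤n⇒m≤1+n i≤) ℓ<) , (λ q q< → cong upper (e (suc P) q ≤-refl (<S⇒<width-suc q<))))
    (λ (a , β) (a' , β') (pa , pβ) → extend-resp {a} {a'} {β} {β'} pa pβ)
    extend-restrict
    (λ (a , β) → restrict-extend a β , twists-extend a β)
    (λ {x} {y} {z} → ≈L-trans {suc P} {x} {y} {z})
    (×-HasCard h (Bits-HasCard S))

labelAutCount : ℕ → ℕ
labelAutCount zero    = 6
labelAutCount (suc d) = labelAutCount d * 2 ^ width (suc d)

LabelAut-HasCard : ∀ d → HasCard (LabelAut (suc d)) _≈L_ (labelAutCount d)
LabelAut-HasCard zero    = LabelAut1-HasCard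
LabelAut-HasCard (suc d) = Extension.LabelAut-suc-HasCard d (LabelAut-HasCard d)

module TreeLabels (n' : ℕ) where

  open Classification n'

  parent^ : ℕ → G n → G n
  parent^ zero    x = x
  parent^ (suc k) x = parent (parent^ k x)

  level-parent^ : ∀ k x → level (parent^ k x) ≡ level x ∸ k
  level-parent^ zero    x = refl
  level-parent^ (suc k) x =
    trans (proj₁ (node-parent (parent^ k x)))
      (trans (cong (_∸ 1) (level-parent^ k x)) (trans (∸-+-assoc (level x) k 1) (cong (level x ∸_) (+-comm k 1))))

  level-zeroG : level zeroG ≡ 0
  level-zeroG = proj₁ (node-rep {0} {0} (z≤n , s≤s z≤n))

  level≡0⇒∼zeroG : ∀ {y} → level y ≡ 0 → y ∼ zeroG
  level≡0⇒∼zeroG {y} e = subst (λ i → y ∼ rep i (label y)) e (∼-rep y)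

  ∼zeroG⇒level≡0 : ∀ {y} → y ∼ zeroG → level y ≡ 0
  ∼zeroG⇒level≡0 p = trans (proj₁ (node-∼ p)) level-zeroG

  level-parent^-level : ∀ x → parent^ (level x) x ∼ zeroG
  level-parent^-level x = level≡0⇒∼zeroG (trans (level-parent^ (level x) x) (n∸n≡0 (level x)))

  module _ (τ : TreeAut n) where

    private
      φ ψ : G n → G n
      φ = proj₁ τ
      ψ = proj₁ (proj₁ (proj₂ (proj₂ τ)))
      φ-resp : RespOrb φ
      φ-resp = proj₁ (proj₂ τ)
      ψ-resp : RespOrb ψ
      ψ-resp = proj₁ (proj₂ (proj₁ (proj₂ (proj₂ τ))))
      ψ∘φ : ∀ x → ψ (φ x) ∼ x
      ψ∘φ = proj₁ (proj₂ (proj₂ (proj₁ (proj₂ (proj₂ τ)))))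
      φ∘ψ : ∀ x → φ (ψ x) ∼ x
      φ∘ψ = proj₂ (proj₂ (proj₂ (proj₁ (proj₂ (proj₂ τ)))))
      φ-root : φ zeroG ∼ zeroG
      φ-root = proj₁ (proj₂ (proj₂ (proj₂ τ)))
      φ-parent : ∀ x → φ (parent x) ∼ parent (φ x)
      φ-parent = proj₂ (proj₂ (proj₂ (proj₂ τ)))

      ψ-root : ψ zeroG ∼ zeroG
      ψ-root = ∼-trans (∼-sym (ψ-resp _ _ φ-root)) (ψ∘φ zeroG)

      φ-parent^ : ∀ k x → φ (parent^ k x) ∼ parent^ k (φ x)
      φ-parent^ zero    x = ∼-refl
      φ-parent^ (suc k) x = ∼-trans (φ-parent (parent^ k x)) (parent-∼ (φ-parent^ k x))

    -- The level of x is the least k with parent^ k x at the root.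
    level-φ : ∀ x → level (φ x) ≡ level x
    level-φ x = ≤-antisym
      (m∸n≡0⇒m≤n (trans (sym (level-parent^ (level x) (φ x)))
        (∼zeroG⇒level≡0 (∼-trans (∼-sym (φ-parent^ (level x) x)) (∼-trans (φ-resp _ _ (level-parent^-level x)) φ-root)))))
      (m∸n≡0⇒m≤n (trans (sym (level-parent^ (level (φ x)) x))
        (∼zeroG⇒level≡0 (∼-trans (∼-sym (ψ∘φ _))
          (∼-trans (ψ-resp _ _ (∼-trans (φ-parent^ (level (φ x)) x) (level-parent^-level (φ x)))) ψ-root)))))

    private
      level-ψ : ∀ x → level (ψ x) ≡ level x
      level-ψ x = trans (sym (level-φ (ψ x))) (proj₁ (node-∼ (φ∘ψ x)))

      rep-label-∼ : ∀ {i} y → level y ≡ i → rep i (label y) ∼ y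
      rep-label-∼ y refl = ∼-sym (∼-rep y)

      level-φ-rep : ∀ {i ℓ} → IsNode i ℓ → level (φ (rep i ℓ)) ≡ i
      level-φ-rep v = trans (level-φ _) (proj₁ (node-rep v))

      level-ψ-rep : ∀ {i ℓ} → IsNode i ℓ → level (ψ (rep i ℓ)) ≡ i
      level-ψ-rep v = trans (level-ψ _) (proj₁ (node-rep v))

    toLabels : LabelAut n
    toLabels = record { f = F ; g = F⁻¹ ; f< = F< ; g< = F⁻¹< ; g∘f = F⁻¹∘F ; f∘g = F∘F⁻¹ ; f-% = F-% }
      where
      F F⁻¹ : ℕ → ℕ → ℕ
      F   i ℓ = label (φ (rep i ℓ))
      F⁻¹ i ℓ = label (ψ (rep i ℓ))
      F< : ∀ {i ℓ} → i ≤ n → ℓ < width i → F i ℓ < width i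
      F< {i} {ℓ} i≤ ℓ< = subst (λ j → F i ℓ < width j) (level-φ-rep (i≤ , ℓ<)) (proj₂ (isNode (φ (rep i ℓ))))
      F⁻¹< : ∀ {i ℓ} → i ≤ n → ℓ < width i → F⁻¹ i ℓ < width i
      F⁻¹< {i} {ℓ} i≤ ℓ< = subst (λ j → F⁻¹ i ℓ < width j) (level-ψ-rep (i≤ , ℓ<)) (proj₂ (isNode (ψ (rep i ℓ))))
      F⁻¹∘F : ∀ {i ℓ} → i ≤ n → ℓ < width i → F⁻¹ i (F i ℓ) ≡ ℓ
      F⁻¹∘F {i} {ℓ} i≤ ℓ< = trans (proj₂ (node-∼ ψφ∼)) (proj₂ (node-rep (i≤ , ℓ<)))
        where
        ψφ∼ : ψ (rep i (F i ℓ)) ∼ rep i ℓ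
        ψφ∼ = ∼-trans (ψ-resp _ _ (rep-label-∼ (φ (rep i ℓ)) (level-φ-rep (i≤ , ℓ<)))) (ψ∘φ (rep i ℓ))
      F∘F⁻¹ : ∀ {i ℓ} → i ≤ n → ℓ < width i → F i (F⁻¹ i ℓ) ≡ ℓ
      F∘F⁻¹ {i} {ℓ} i≤ ℓ< = trans (proj₂ (node-∼ φψ∼)) (proj₂ (node-rep (i≤ , ℓ<)))
        where
        φψ∼ : φ (rep i (F⁻¹ i ℓ)) ∼ rep i ℓ
        φψ∼ = ∼-trans (φ-resp _ _ (rep-label-∼ (ψ (rep i ℓ)) (level-ψ-rep (i≤ , ℓ<)))) (φ∘ψ (rep i ℓ))
      F-% : ∀ {i ℓ} → suc i ≤ n → ℓ < width (suc i) → F i (ℓ %width i) ≡ F (suc i) ℓ %width i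
      F-% {i} {ℓ} i≤ ℓ< = begin
        label (φ (rep i (ℓ %width i)))       ≡⟨ cong (λ z → label (φ z)) (parent-rep (suc i) ℓ (i≤ , ℓ<)) ⟨
        label (φ (parent y))                 ≡⟨ proj₂ (node-∼ (φ-parent y)) ⟩
        label (parent (φ y))                 ≡⟨ proj₂ (node-parent (φ y)) ⟩
        F (suc i) ℓ %width (level (φ y) ∸ 1) ≡⟨ cong (λ j → F (suc i) ℓ %width (j ∸ 1)) (level-φ-rep (i≤ , ℓ<)) ⟩
        F (suc i) ℓ %width i                 ∎
        where
        open ≡-Reasoning
        y = rep (suc i) ℓ

  module _ (a : LabelAut n) where

    private
      onNodes : (ℕ → ℕ → ℕ) → G n → G n
      onNodes h x = rep (level x) (h (level x) (label x))

      onNodes-resp : ∀ h → RespOrb (onNodes h)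
      onNodes-resp h x y p = ≡⇒∼ (cong₂ (λ i ℓ → rep i (h i ℓ)) (proj₁ (node-∼ p)) (proj₂ (node-∼ p)))

      node-onNodes : ∀ h → (∀ {i ℓ} → i ≤ n → ℓ < width i → h i ℓ < width i) → ∀ x →
                     level (onNodes h x) ≡ level x × label (onNodes h x) ≡ h (level x) (label x)
      node-onNodes h h< x = node-rep (proj₁ (isNode x) , h< (proj₁ (isNode x)) (proj₂ (isNode x)))

      onNodes-inverse : ∀ h h' → (∀ {i ℓ} → i ≤ n → ℓ < width i → h i ℓ < width i) →
                        (∀ {i ℓ} → i ≤ n → ℓ < width i → h' i (h i ℓ) ≡ ℓ) → ∀ x →
                        onNodes h' (onNodes h x) ∼ x
      onNodes-inverse h h' h< h'∘h x = subst (_∼ x) (sym e) (∼-sym (∼-rep x))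
        where
        nd = node-onNodes h h< x
        e : onNodes h' (onNodes h x) ≡ rep (level x) (label x)
        e = trans (cong₂ (λ i ℓ → rep i (h' i ℓ)) (proj₁ nd) (proj₂ nd))
                  (cong (rep (level x)) (h'∘h (proj₁ (isNode x)) (proj₂ (isNode x))))

      onNodes-parent : ∀ x → onNodes (f a) (parent x) ≡ parent (onNodes (f a) x)
      onNodes-parent x = begin
        rep (level (parent x)) (f a (level (parent x)) (label (parent x)))
          ≡⟨ cong₂ (λ i ℓ → rep i (f a i ℓ)) (proj₁ (node-parent x)) (proj₂ (node-parent x)) ⟩
        rep (L ∸ 1) (f a (L ∸ 1) (I %width (L ∸ 1)))
          ≡⟨ f-%-rep L (isNode x) ⟩
        rep (L ∸ 1) (f a L I %width (L ∸ 1))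
          ≡⟨ parent-rep L (f a L I) (proj₁ (isNode x) , f< a (proj₁ (isNode x)) (proj₂ (isNode x))) ⟨
        parent (rep L (f a L I))
          ∎
        where
        open ≡-Reasoning
        L = level x
        I = label x
        f-%-rep : ∀ L → IsNode L I → rep (L ∸ 1) (f a (L ∸ 1) (I %width (L ∸ 1))) ≡ rep (L ∸ 1) (f a L I %width (L ∸ 1))
        f-%-rep zero    _          = refl
        f-%-rep (suc L) (L≤ , I<)  = cong (rep L) (f-% a L≤ I<)

    fromLabels : TreeAut n
    fromLabels =
      onNodes (f a) , onNodes-resp (f a) ,
      (onNodes (g a) , onNodes-resp (g a) , onNodes-inverse (f a) (g a) (f< a) (g∘f a) , onNodes-inverse (g a) (f a) (g< a) (f∘g a)) ,
      ≡⇒∼ (cong (λ i → rep i (f a i (label zeroG))) level-zeroG) ,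
      (λ x → ≡⇒∼ (onNodes-parent x))

  toLabels-fromLabels : ∀ a → toLabels (fromLabels a) ≈L a
  toLabels-fromLabels a i ℓ i≤ ℓ< =
    trans (proj₂ (node-rep (proj₁ v , f< a (proj₁ v) (proj₂ v)))) (cong₂ (f a) (proj₁ nd) (proj₂ nd))
    where
    nd = node-rep {i} {ℓ} (i≤ , ℓ<)
    v = isNode (rep i ℓ)

  fromLabels-toLabels : ∀ τ → fromLabels (toLabels τ) ≈T τ
  fromLabels-toLabels τ x = ∼-trans (subst (_∼ proj₁ τ y) (sym e) (∼-sym (∼-rep (proj₁ τ y))))
                                    (proj₁ (proj₂ τ) _ _ (∼-sym (∼-rep x)))
    where
    y = rep (level x) (label x)
    e : rep (level x) (label (proj₁ τ y)) ≡ rep (level (proj₁ τ y)) (label (proj₁ τ y))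
    e = cong (λ i → rep i (label (proj₁ τ y))) (sym (trans (level-φ τ y) (proj₁ (node-rep (isNode x)))))

  TreeAut-HasCard : ∀ {k} → HasCard (LabelAut n) _≈L_ k → HasCard (TreeAut n) _≈T_ k
  TreeAut-HasCard = HasCard-transport fromLabels toLabels
    (λ τ τ' p i ℓ _ _ → proj₂ (node-∼ (p (rep i ℓ))))
    (λ a a' p x → ≡⇒∼ (cong (rep (level x)) (p (level x) (label x) (proj₁ (isNode x)) (proj₂ (isNode x)))))
    fromLabels-toLabels toLabels-fromLabels
    (λ p q x → ∼-trans (p x) (q x))

-- Automorphisms of G_n

cong₄ : ∀ {A : Set} (F : ℕ → ℕ → ℕ → ℕ → A) {a a' b b' c c' e e'} →
        a ≡ a' → b ≡ b' → c ≡ c' → e ≡ e' → F a b c e ≡ F a' b' c' e'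
cong₄ F refl refl refl refl = refl

bit+2x%2 : ∀ b x → b < 2 → (b + 2 * x) % 2 ≡ b
bit+2x%2 b x b< = trans (cong (λ z → (b + z) % 2) (*-comm 2 x)) (proj₂ (divMod-unique b x 2 b<))

bit+2x/2 : ∀ b x → b < 2 → (b + 2 * x) / 2 ≡ x
bit+2x/2 b x b< = trans (cong (λ z → (b + z) / 2) (*-comm 2 x)) (proj₁ (divMod-unique b x 2 b<))

x%2+2[x/2] : ∀ x → x % 2 + 2 * (x / 2) ≡ x
x%2+2[x/2] x = sym (trans (m≡m%n+[m/n]*n x 2) (cong (x % 2 +_) (*-comm (x / 2) 2)))

odd-*-%2 : ∀ {u} x → Odd u → (u * x) % 2 ≡ x % 2
odd-*-%2 {u} x ou = trans (%-distribˡ-* u x 2) (trans (cong (λ z → (z * (x % 2)) % 2) (odd⇒%2≡1 ou))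
                      (trans (cong (_% 2) (*-identityˡ (x % 2))) (m%n%n≡m%n x 2)))

module Parity = Congruence 2

-- A matrix with rows (p, q) and (r, s); K ≡ -1 modulo 2^n stands in for subtraction.
module Matrices (n' : ℕ) where

  open Coordinates n' public

  K : ℕ
  K = 2 ^ n ∸ 1

  2^n≡1+K : 2 ^ n ≡ suc K
  2^n≡1+K = sym (m+[n∸m]≡n (2^k>0 n))

  K-odd : Odd K
  K-odd = 2 ^ n' ∸ 1 , (begin
    2 * 2 ^ n' ∸ 1             ≡⟨ cong (λ z → 2 * z ∸ 1) (sym (m+[n∸m]≡n (2^k>0 n'))) ⟩
    2 * suc (2 ^ n' ∸ 1) ∸ 1   ≡⟨ cong (_∸ 1) (regroup (2 ^ n' ∸ 1)) ⟩
    suc (2 * (2 ^ n' ∸ 1))     ∎)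
    where
    open ≡-Reasoning
    regroup : ∀ x → 2 * suc x ≡ 1 + suc (2 * x)
    regroup = solve-∀

  +*2^n≅ : ∀ A X → A + X * suc K ≅ A
  +*2^n≅ A X = trans (cong (λ z → (A + X * z) % 2 ^ n) (sym 2^n≡1+K)) ([m+kn]%n≡m%n A X (2 ^ n))

  *2^n+≅ : ∀ A X → X * suc K + A ≅ A
  *2^n+≅ A X = trans (cong (_% 2 ^ n) (+-comm (X * suc K) A)) (+*2^n≅ A X)

  e₁ e₂ : G n
  e₁ = mk 1 0
  e₂ = mk 0 1

  lin : ℕ → ℕ → ℕ → ℕ → G n → G n
  lin p q r s x = mk (c₁ x * p + c₂ x * q) (c₁ x * r + c₂ x * s)

  lin-mk : ∀ p q r s a b → lin p q r s (mk a b) ≡ mk (a * p + b * q) (a * r + b * s)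
  lin-mk p q r s a b = mk-cong (+-≅ (*-≅ (c₁-mk-≅ a b) refl) (*-≅ (c₂-mk-≅ a b) refl))
                               (+-≅ (*-≅ (c₁-mk-≅ a b) refl) (*-≅ (c₂-mk-≅ a b) refl))

  lin-⊕ : ∀ p q r s x y → lin p q r s (x ⊕ y) ≡ lin p q r s x ⊕ lin p q r s y
  lin-⊕ p q r s x y =
    trans (lin-mk p q r s (c₁ x + c₁ y) (c₂ x + c₂ y))
      (trans (cong₂ mk (distrib (c₁ x) (c₁ y) (c₂ x) (c₂ y) p q) (distrib (c₁ x) (c₁ y) (c₂ x) (c₂ y) r s))
             (sym (⊕-mk _ _ _ _)))
    where
    distrib : ∀ a a' b b' p q → (a + a') * p + (b + b') * q ≡ (a * p + b * q) + (a' * p + b' * q)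
    distrib = solve-∀

  lin-· : ∀ p q r s u x → lin p q r s (u · x) ≡ u · lin p q r s x
  lin-· p q r s u x =
    trans (lin-mk p q r s (u * c₁ x) (u * c₂ x))
      (trans (cong₂ mk (regroup u (c₁ x) (c₂ x) p q) (regroup u (c₁ x) (c₂ x) r s)) (sym (·-mk u _ _)))
    where
    regroup : ∀ u a b p q → u * a * p + u * b * q ≡ u * (a * p + b * q)
    regroup = solve-∀

  lin-scale : ∀ w p q r s x → lin (w * p) (w * q) (w * r) (w * s) x ≡ w · lin p q r s x
  lin-scale w p q r s x =
    trans (cong₂ mk (regroup w (c₁ x) (c₂ x) p q) (regroup w (c₁ x) (c₂ x) r s)) (sym (·-mk w _ _))
    where
    regroup : ∀ w a b p q → a * (w * p) + b * (w * q) ≡ w * (a * p + b * q)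
    regroup = solve-∀

  lin-RespOrb : ∀ p q r s → RespOrb (lin p q r s)
  lin-RespOrb p q r s x y (u , iu , e) = u , iu , trans (cong (lin p q r s) e) (lin-· p q r s u x)

  lin-cong : ∀ {p q r s p' q' r' s'} x → p ≅ p' → q ≅ q' → r ≅ r' → s ≅ s' → lin p q r s x ≡ lin p' q' r' s' x
  lin-cong x ep eq er es = mk-cong (+-≅ (*-≅ {c₁ x} refl ep) (*-≅ {c₂ x} refl eq))
                                   (+-≅ (*-≅ {c₁ x} refl er) (*-≅ {c₂ x} refl es))

  lin-columns : ∀ p q r s → p < 2 ^ n → q < 2 ^ n → r < 2 ^ n → s < 2 ^ n →
    c₁ (lin p q r s e₁) ≡ p × c₂ (lin p q r s e₁) ≡ r × c₁ (lin p q r s e₂) ≡ q × c₂ (lin p q r s e₂) ≡ s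
  lin-columns p q r s p< q< r< s< =
    trans (cong c₁ (lin-mk p q r s 1 0)) (trans (c₁-mk _ (1 * r + 0 * s)) (reduce (first p q) p<)) ,
    trans (cong c₂ (lin-mk p q r s 1 0)) (trans (c₂-mk (1 * p + 0 * q) _) (reduce (first r s) r<)) ,
    trans (cong c₁ (lin-mk p q r s 0 1)) (trans (c₁-mk _ (0 * r + 1 * s)) (reduce (second p q) q<)) ,
    trans (cong c₂ (lin-mk p q r s 0 1)) (trans (c₂-mk (0 * p + 1 * q) _) (reduce (second r s) s<))
    where
    first : ∀ p q → 1 * p + 0 * q ≡ p
    first = solve-∀
    second : ∀ p q → 0 * p + 1 * q ≡ q
    second = solve-∀
    reduce : ∀ {x y} → x ≡ y → y < 2 ^ n → x % 2 ^ n ≡ y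
    reduce e y< = trans (cong (_% 2 ^ n) e) (m<n⇒m%n≡m y<)

  Det : ℕ → ℕ → ℕ → ℕ → ℕ
  Det p q r s = p * s + q * r * K

  Det-%2 : ∀ p q r s → Det p q r s % 2 ≡ ((p % 2) * (s % 2) + (q % 2) * (r % 2)) % 2
  Det-%2 p q r s = Parity.+-≅ {p * s} {(p % 2) * (s % 2)} {q * r * K} {(q % 2) * (r % 2)}
    (Parity.*-≅ {p} {p % 2} {s} {s % 2} (sym (Parity.%-≅ p)) (sym (Parity.%-≅ s)))
    (trans (Parity.*-≅ {q * r} {(q % 2) * (r % 2)} {K} {1}
             (Parity.*-≅ {q} {q % 2} {r} {r % 2} (sym (Parity.%-≅ q)) (sym (Parity.%-≅ r))) (odd⇒%2≡1 K-odd))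
           (cong (_% 2) (*-identityʳ ((q % 2) * (r % 2)))))

  Det-cong : ∀ {p q r s p' q' r' s'} → p ≅ p' → q ≅ q' → r ≅ r' → s ≅ s' → Det p q r s ≅ Det p' q' r' s'
  Det-cong ep eq er es = +-≅ (*-≅ ep es) (*-≅ (*-≅ eq er) (refl {x = K % 2 ^ n}))

  Det-scale : ∀ w p q r s → Det (w * p) (w * q) (w * r) (w * s) ≡ w * w * Det p q r s
  Det-scale w p q r s = regroup w p q r s K
    where
    regroup : ∀ w p q r s K → w * p * (w * s) + w * q * (w * r) * K ≡ w * w * (p * s + q * r * K)
    regroup = solve-∀

  -- The adjugate  (s, K q; K r, p)  scaled by the inverse of the determinant.
  module Inverse (p q r s : ℕ) (det-odd : Odd (Det p q r s)) where

    private
      D = Det p q r s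
      w = inv n D

    p' q' r' s' : ℕ
    p' = w * s
    q' = w * q * K
    r' = w * r * K
    s' = w * p

    private
      w*D* : ∀ a → w * D * a ≅ a
      w*D* a = trans (*-≅ {w * D} {1} {a} (inv-inverseˡ n det-odd) refl) (cong (_% 2 ^ n) (*-identityˡ a))

    lin-inverseˡ : ∀ x → lin p' q' r' s' (lin p q r s x) ≡ x
    lin-inverseˡ x = trans (lin-mk p' q' r' s' A B)
      (G-≡ (trans (c₁-mk-≅ X Y) (trans (cong (_% 2 ^ n) (first (c₁ x) (c₂ x) p q r s w K))
                                (trans (+*2^n≅ (w * D * c₁ x) (w * c₂ x * q * s)) (w*D* (c₁ x)))))
           (trans (c₂-mk-≅ X Y) (trans (cong (_% 2 ^ n) (second (c₁ x) (c₂ x) p q r s w K))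
                                (trans (*2^n+≅ (w * D * c₂ x) (w * c₁ x * p * r)) (w*D* (c₂ x))))))
      where
      A = c₁ x * p + c₂ x * q
      B = c₁ x * r + c₂ x * s
      X = A * p' + B * q'
      Y = A * r' + B * s'
      first : ∀ a b p q r s w K → (a * p + b * q) * (w * s) + (a * r + b * s) * (w * q * K)
                                  ≡ w * (p * s + q * r * K) * a + (w * b * q * s) * (1 + K)
      first = solve-∀
      second : ∀ a b p q r s w K → (a * p + b * q) * (w * r * K) + (a * r + b * s) * (w * p)
                                   ≡ (w * a * p * r) * (1 + K) + w * (p * s + q * r * K) * b
      second = solve-∀

    lin-inverseʳ : ∀ x → lin p q r s (lin p' q' r' s' x) ≡ x
    lin-inverseʳ x = trans (lin-mk p q r s A B)
      (G-≡ (trans (c₁-mk-≅ X Y) (trans (cong (_% 2 ^ n) (first (c₁ x) (c₂ x) p q r s w K))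
                                (trans (+*2^n≅ (w * D * c₁ x) (w * c₂ x * p * q)) (w*D* (c₁ x)))))
           (trans (c₂-mk-≅ X Y) (trans (cong (_% 2 ^ n) (second (c₁ x) (c₂ x) p q r s w K))
                                (trans (*2^n+≅ (w * D * c₂ x) (w * c₁ x * r * s)) (w*D* (c₂ x))))))
      where
      A = c₁ x * p' + c₂ x * q'
      B = c₁ x * r' + c₂ x * s'
      X = A * p + B * q
      Y = A * r + B * s
      first : ∀ a b p q r s w K → (a * (w * s) + b * (w * q * K)) * p + (a * (w * r * K) + b * (w * p)) * q
                                  ≡ w * (p * s + q * r * K) * a + (w * b * p * q) * (1 + K)
      first = solve-∀
      second : ∀ a b p q r s w K → (a * (w * s) + b * (w * q * K)) * r + (a * (w * r * K) + b * (w * p)) * s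
                                   ≡ (w * a * r * s) * (1 + K) + w * (p * s + q * r * K) * b
      second = solve-∀

    groupAut : GroupAut n
    groupAut = lin p q r s , lin-⊕ p q r s , lin p' q' r' s' , lin-inverseˡ , lin-inverseʳ

    treeAut : TreeAut n
    treeAut = lin p q r s , lin-RespOrb p q r s ,
              (lin p' q' r' s' , lin-RespOrb p' q' r' s' , (λ x → ≡⇒∼ (lin-inverseˡ x)) , (λ x → ≡⇒∼ (lin-inverseʳ x))) ,
              ≡⇒∼ (lin-mk p q r s 0 0) , (λ x → ≡⇒∼ (lin-⊕ p q r s x x))

module GroupAutomorphisms (n' : ℕ) where

  open Matrices n' public

  h : ℕ
  h = 2 ^ n'

  instance
    h≢0 : NonZero h
    h≢0 = 2^k≢0 n'

  h≇0 : ¬ (h ≅ 0)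
  h≇0 e = <⇒≢ (2^k>0 n') (sym (trans (sym (m<n⇒m%n≡m (2^-mono-< {n'} {n} ≤-refl))) (trans e (m<n⇒m%n≡m (2^k>0 n)))))

  h*even≅0 : ∀ x → x % 2 ≡ 0 → h * x ≅ 0
  h*even≅0 x e = trans (cong (_% 2 ^ n) (trans (cong (h *_) (trans (m≡m%n+[m/n]*n x 2) (cong (_+ (x / 2) * 2) e)))
                                              (regroup h (x / 2))))
                       (*d≅0 (x / 2))
    where
    regroup : ∀ h y → h * (0 + y * 2) ≡ y * (2 * h)
    regroup = solve-∀

  idempotent⇒≅0 : ∀ {c} → c ≡ (c + c) % 2 ^ n → c ≅ 0
  idempotent⇒≅0 {c} e =
    sym (+-cancelˡ-≅ c (trans (cong (_% 2 ^ n) (+-identityʳ c)) (trans (cong (_% 2 ^ n) e) (%-≅ (c + c)))))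

  module Additive (σ : G n → G n) (σ-⊕ : ∀ x y → σ (x ⊕ y) ≡ σ x ⊕ σ y) where

    p q r s : ℕ
    p = c₁ (σ e₁)
    r = c₂ (σ e₁)
    q = c₁ (σ e₂)
    s = c₂ (σ e₂)

    σ-zero : σ (mk 0 0) ≡ mk 0 0
    σ-zero = G-≡ (trans (idempotent⇒≅0 (trans (cong c₁ y≡y⊕y) (c₁-mk (c₁ y + c₁ y) (c₂ y + c₂ y)))) (sym (c₁-mk-≅ 0 0)))
                 (trans (idempotent⇒≅0 (trans (cong c₂ y≡y⊕y) (c₂-mk (c₁ y + c₁ y) (c₂ y + c₂ y)))) (sym (c₂-mk-≅ 0 0)))
      where
      y = σ (mk 0 0)
      y≡y⊕y : y ≡ y ⊕ y
      y≡y⊕y = trans (cong σ (sym (⊕-mk 0 0 0 0))) (σ-⊕ (mk 0 0) (mk 0 0))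

    σ-mk-a0 : ∀ a → σ (mk a 0) ≡ mk (a * p) (a * r)
    σ-mk-a0 zero    = σ-zero
    σ-mk-a0 (suc a) = begin
      σ (mk (suc a) 0)                 ≡⟨ cong σ (trans (mk-cong (≡⇒≅ (+-comm 1 a)) refl) (sym (⊕-mk a 0 1 0))) ⟩
      σ (mk a 0 ⊕ e₁)                  ≡⟨ σ-⊕ (mk a 0) e₁ ⟩
      σ (mk a 0) ⊕ σ e₁                ≡⟨ cong₂ _⊕_ (σ-mk-a0 a) (sym (mk-η (σ e₁))) ⟩
      mk (a * p) (a * r) ⊕ mk p r      ≡⟨ ⊕-mk (a * p) (a * r) p r ⟩
      mk (a * p + p) (a * r + r)       ≡⟨ cong₂ mk (+-comm (a * p) p) (+-comm (a * r) r) ⟩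
      mk (suc a * p) (suc a * r)       ∎
      where open ≡-Reasoning

    σ-mk-0b : ∀ b → σ (mk 0 b) ≡ mk (b * q) (b * s)
    σ-mk-0b zero    = σ-zero
    σ-mk-0b (suc b) = begin
      σ (mk 0 (suc b))                 ≡⟨ cong σ (trans (mk-cong refl (≡⇒≅ (+-comm 1 b))) (sym (⊕-mk 0 b 0 1))) ⟩
      σ (mk 0 b ⊕ e₂)                  ≡⟨ σ-⊕ (mk 0 b) e₂ ⟩
      σ (mk 0 b) ⊕ σ e₂                ≡⟨ cong₂ _⊕_ (σ-mk-0b b) (sym (mk-η (σ e₂))) ⟩
      mk (b * q) (b * s) ⊕ mk q s      ≡⟨ ⊕-mk (b * q) (b * s) q s ⟩
      mk (b * q + q) (b * s + s)       ≡⟨ cong₂ mk (+-comm (b * q) q) (+-comm (b * s) s) ⟩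
      mk (suc b * q) (suc b * s)       ∎
      where open ≡-Reasoning

    σ-mk : ∀ a b → σ (mk a b) ≡ mk (a * p + b * q) (a * r + b * s)
    σ-mk a b = begin
      σ (mk a b)                               ≡⟨ cong σ (trans (cong₂ mk (sym (+-identityʳ a)) refl) (sym (⊕-mk a 0 0 b))) ⟩
      σ (mk a 0 ⊕ mk 0 b)                      ≡⟨ σ-⊕ (mk a 0) (mk 0 b) ⟩
      σ (mk a 0) ⊕ σ (mk 0 b)                  ≡⟨ cong₂ _⊕_ (σ-mk-a0 a) (σ-mk-0b b) ⟩
      mk (a * p) (a * r) ⊕ mk (b * q) (b * s)  ≡⟨ ⊕-mk (a * p) (a * r) (b * q) (b * s) ⟩
      mk (a * p + b * q) (a * r + b * s)       ∎
      where open ≡-Reasoning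

    σ≡lin : ∀ x → σ x ≡ lin p q r s x
    σ≡lin x = trans (cong σ (sym (mk-η x))) (σ-mk (c₁ x) (c₂ x))

  module Automorphism (σ : GroupAut n) where

    open Additive (proj₁ σ) (proj₁ (proj₂ σ)) public

    σ≡0⇒≅0 : ∀ a b → proj₁ σ (mk a b) ≡ mk 0 0 → a ≅ 0 × b ≅ 0
    σ≡0⇒≅0 a b e = mk-injective₁ mk≡0 , mk-injective₂ mk≡0
      where
      σ⁻¹ = proj₁ (proj₂ (proj₂ σ))
      σ⁻¹∘σ = proj₁ (proj₂ (proj₂ (proj₂ σ)))
      mk≡0 : mk a b ≡ mk 0 0
      mk≡0 = trans (sym (σ⁻¹∘σ (mk a b))) (trans (cong σ⁻¹ (trans e (sym σ-zero))) (σ⁻¹∘σ (mk 0 0)))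

    column₁-odd : p % 2 ≡ 0 → r % 2 ≡ 0 → ⊥
    column₁-odd ep er = h≇0 (proj₁ (σ≡0⇒≅0 h 0 (trans (σ-mk h 0) (mk-cong (killed {p} {q} ep) (killed {r} {s} er)))))
      where
      killed : ∀ {x y} → x % 2 ≡ 0 → h * x + 0 * y ≅ 0
      killed {x} e = trans (cong (_% 2 ^ n) (+-identityʳ (h * x))) (h*even≅0 x e)

    column₂-odd : q % 2 ≡ 0 → s % 2 ≡ 0 → ⊥
    column₂-odd eq es = h≇0 (proj₂ (σ≡0⇒≅0 0 h (trans (σ-mk 0 h) (mk-cong (h*even≅0 q eq) (h*even≅0 s es)))))

    columns-sum-odd : (p + q) % 2 ≡ 0 → (r + s) % 2 ≡ 0 → ⊥
    columns-sum-odd e₁′ e₂′ = h≇0 (proj₁ (σ≡0⇒≅0 h h (trans (σ-mk h h) (mk-cong (killed e₁′) (killed e₂′)))))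
      where
      killed : ∀ {x y} → (x + y) % 2 ≡ 0 → h * x + h * y ≅ 0
      killed {x} {y} e = trans (cong (_% 2 ^ n) (sym (*-distribˡ-+ h x y))) (h*even≅0 (x + y) e)

    -- If the determinant were even, σ would kill  h·e₁, h·e₂  or  h·(e₁ + e₂).
    Det-odd : Det p q r s % 2 ≡ 1
    Det-odd = go (%2-cases p) (%2-cases q) (%2-cases r) (%2-cases s)
      where
      Parities = λ x → (x % 2 ≡ 0) ⊎ (x % 2 ≡ 1)
      sum-%2 : ∀ x y {X Y} → x % 2 ≡ X → y % 2 ≡ Y → (x + y) % 2 ≡ (X + Y) % 2
      sum-%2 x y ex ey = trans (%-distribˡ-+ x y 2) (cong₂ (λ a b → (a + b) % 2) ex ey)
      Det-%2′ : ∀ {P Q R S} → p % 2 ≡ P → q % 2 ≡ Q → r % 2 ≡ R → s % 2 ≡ S → Det p q r s % 2 ≡ (P * S + Q * R) % 2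
      Det-%2′ refl refl refl refl = Det-%2 p q r s
      go : Parities p → Parities q → Parities r → Parities s → Det p q r s % 2 ≡ 1
      go (inj₁ ep) _         (inj₁ er) _         = ⊥-elim (column₁-odd ep er)
      go _         (inj₁ eq) _         (inj₁ es) = ⊥-elim (column₂-odd eq es)
      go (inj₁ ep) (inj₁ eq) (inj₂ er) (inj₂ es) = ⊥-elim (columns-sum-odd (sum-%2 p q ep eq) (sum-%2 r s er es))
      go (inj₂ ep) (inj₂ eq) (inj₁ er) (inj₁ es) = ⊥-elim (columns-sum-odd (sum-%2 p q ep eq) (sum-%2 r s er es))
      go (inj₂ ep) (inj₂ eq) (inj₂ er) (inj₂ es) = ⊥-elim (columns-sum-odd (sum-%2 p q ep eq) (sum-%2 r s er es))
      go (inj₁ ep) (inj₂ eq) (inj₂ er) (inj₁ es) = Det-%2′ ep eq er es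
      go (inj₁ ep) (inj₂ eq) (inj₂ er) (inj₂ es) = Det-%2′ ep eq er es
      go (inj₂ ep) (inj₁ eq) (inj₁ er) (inj₂ es) = Det-%2′ ep eq er es
      go (inj₂ ep) (inj₁ eq) (inj₂ er) (inj₂ es) = Det-%2′ ep eq er es
      go (inj₂ ep) (inj₂ eq) (inj₁ er) (inj₂ es) = Det-%2′ ep eq er es
      go (inj₂ ep) (inj₂ eq) (inj₂ er) (inj₁ es) = Det-%2′ ep eq er es

-- The six invertible 2×2 matrices over 𝔽₂, with entries (glP k, glQ k; glR k, glS k).
glP glQ glR glS : ℕ → ℕ
glP 3 = 0
glP 4 = 0
glP _ = 1
glQ 2 = 1
glQ 3 = 1
glQ 4 = 1
glQ 5 = 1
glQ _ = 0
glR 1 = 1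
glR 3 = 1
glR 4 = 1
glR 5 = 1
glR _ = 0
glS 3 = 0
glS 5 = 0
glS _ = 1

glIndex : ℕ → ℕ → ℕ → ℕ → Below 6
glIndex 1 0 0 1 = 0 , s≤s z≤n
glIndex 1 0 1 1 = 1 , s≤s (s≤s z≤n)
glIndex 1 1 0 1 = 2 , s≤s (s≤s (s≤s z≤n))
glIndex 0 1 1 0 = 3 , s≤s (s≤s (s≤s (s≤s z≤n)))
glIndex 0 1 1 1 = 4 , s≤s (s≤s (s≤s (s≤s (s≤s z≤n))))
glIndex 1 1 1 0 = 5 , s≤s (s≤s (s≤s (s≤s (s≤s (s≤s z≤n)))))
glIndex _ _ _ _ = 0 , s≤s z≤n

glP<2 : ∀ k → glP k < 2
glP<2 3 = s≤s z≤n
glP<2 4 = s≤s z≤n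
glP<2 0 = s≤s (s≤s z≤n)
glP<2 1 = s≤s (s≤s z≤n)
glP<2 2 = s≤s (s≤s z≤n)
glP<2 (suc (suc (suc (suc (suc k))))) = s≤s (s≤s z≤n)

glQ<2 : ∀ k → glQ k < 2
glQ<2 0 = s≤s z≤n
glQ<2 1 = s≤s z≤n
glQ<2 2 = s≤s (s≤s z≤n)
glQ<2 3 = s≤s (s≤s z≤n)
glQ<2 4 = s≤s (s≤s z≤n)
glQ<2 5 = s≤s (s≤s z≤n)
glQ<2 (suc (suc (suc (suc (suc (suc k)))))) = s≤s z≤n

glR<2 : ∀ k → glR k < 2
glR<2 0 = s≤s z≤n
glR<2 1 = s≤s (s≤s z≤n)
glR<2 2 = s≤s z≤n
glR<2 3 = s≤s (s≤s z≤n)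
glR<2 4 = s≤s (s≤s z≤n)
glR<2 5 = s≤s (s≤s z≤n)
glR<2 (suc (suc (suc (suc (suc (suc k)))))) = s≤s z≤n

glS<2 : ∀ k → glS k < 2
glS<2 3 = s≤s z≤n
glS<2 5 = s≤s z≤n
glS<2 0 = s≤s (s≤s z≤n)
glS<2 1 = s≤s (s≤s z≤n)
glS<2 2 = s≤s (s≤s z≤n)
glS<2 4 = s≤s (s≤s z≤n)
glS<2 (suc (suc (suc (suc (suc (suc k)))))) = s≤s (s≤s z≤n)

gl-det-odd : ∀ k → (glP k * glS k + glQ k * glR k) % 2 ≡ 1
gl-det-odd 0 = refl
gl-det-odd 1 = refl
gl-det-odd 2 = refl
gl-det-odd 3 = refl
gl-det-odd 4 = refl
gl-det-odd 5 = refl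
gl-det-odd (suc (suc (suc (suc (suc (suc k)))))) = refl

glIndex-gl : ∀ k → k < 6 → proj₁ (glIndex (glP k) (glQ k) (glR k) (glS k)) ≡ k
glIndex-gl 0 _ = refl
glIndex-gl 1 _ = refl
glIndex-gl 2 _ = refl
glIndex-gl 3 _ = refl
glIndex-gl 4 _ = refl
glIndex-gl 5 _ = refl
glIndex-gl (suc (suc (suc (suc (suc (suc k)))))) (s≤s (s≤s (s≤s (s≤s (s≤s (s≤s ()))))))

gl-glIndex : ∀ P Q R S → P < 2 → Q < 2 → R < 2 → S < 2 → (P * S + Q * R) % 2 ≡ 1 →
             glP (proj₁ (glIndex P Q R S)) ≡ P × glQ (proj₁ (glIndex P Q R S)) ≡ Q ×
             glR (proj₁ (glIndex P Q R S)) ≡ R × glS (proj₁ (glIndex P Q R S)) ≡ S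
gl-glIndex 0 1 1 0 _ _ _ _ _ = refl , refl , refl , refl
gl-glIndex 0 1 1 1 _ _ _ _ _ = refl , refl , refl , refl
gl-glIndex 1 0 0 1 _ _ _ _ _ = refl , refl , refl , refl
gl-glIndex 1 0 1 1 _ _ _ _ _ = refl , refl , refl , refl
gl-glIndex 1 1 0 1 _ _ _ _ _ = refl , refl , refl , refl
gl-glIndex 1 1 1 0 _ _ _ _ _ = refl , refl , refl , refl
gl-glIndex 0 0 _ _ _ _ _ _ ()
gl-glIndex 0 1 0 _ _ _ _ _ ()
gl-glIndex 1 0 0 0 _ _ _ _ ()
gl-glIndex 1 0 1 0 _ _ _ _ ()
gl-glIndex 1 1 0 0 _ _ _ _ ()
gl-glIndex 1 1 1 1 _ _ _ _ ()
gl-glIndex (suc (suc _)) _ _ _ (s≤s (s≤s ())) _ _ _ _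
gl-glIndex _ (suc (suc _)) _ _ _ (s≤s (s≤s ())) _ _ _
gl-glIndex _ _ (suc (suc _)) _ _ _ (s≤s (s≤s ())) _ _
gl-glIndex _ _ _ (suc (suc _)) _ _ _ (s≤s (s≤s ())) _

withParity : ℕ → ℕ → ℕ
withParity b x = b + 2 * x

withParity%2 : ∀ {b} x → b < 2 → withParity b x % 2 ≡ b
withParity%2 x b< = bit+2x%2 _ x b<

withParity/2 : ∀ {b} x → b < 2 → withParity b x / 2 ≡ x
withParity/2 x b< = bit+2x/2 _ x b<

withParity-%2-/2 : ∀ {b} x → b ≡ x % 2 → withParity b (x / 2) ≡ x
withParity-%2-/2 x refl = x%2+2[x/2] x

module GroupCount (n' : ℕ) where

  open GroupAutomorphisms n' public

  -- A matrix with odd determinant is its reduction mod 2, one of six,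
  -- together with the halves of its four entries.
  Lifts : Set
  Lifts = Below 6 × (Below h × (Below h × (Below h × Below h)))

  _≈Lifts_ : Lifts → Lifts → Set
  _≈Lifts_ = ×-Pointwise _≈Below_ (×-Pointwise _≈Below_ (×-Pointwise _≈Below_ (×-Pointwise _≈Below_ _≈Below_)))

  Lifts-HasCard : HasCard Lifts _≈Lifts_ (6 * (h * (h * (h * h))))
  Lifts-HasCard = ×-HasCard (Below-HasCard 6)
    (×-HasCard (Below-HasCard h) (×-HasCard (Below-HasCard h) (×-HasCard (Below-HasCard h) (Below-HasCard h))))

  half< : ∀ x → x < 2 ^ n → x / 2 < h
  half< x p = m<n*o⇒m/o<n (subst (x <_) (*-comm 2 h) p)

  withParity< : ∀ {b} x → b < 2 → x < h → withParity b x < 2 ^ n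
  withParity< {b} x (s≤s b≤1) x< =
    ≤-trans (s≤s (+-monoˡ-≤ (2 * x) b≤1)) (≤-trans (≤-reflexive (regroup x)) (*-monoʳ-≤ 2 x<))
    where
    regroup : ∀ x → suc (1 + 2 * x) ≡ 2 * suc x
    regroup = solve-∀

  module Lift (k p₁ q₁ r₁ s₁ : ℕ) where

    p q r s : ℕ
    p = withParity (glP k) p₁
    q = withParity (glQ k) q₁
    r = withParity (glR k) r₁
    s = withParity (glS k) s₁

    det-odd : Det p q r s % 2 ≡ 1
    det-odd = trans (Det-%2 p q r s)
      (trans (cong₂ (λ a b → (a + b) % 2)
                (cong₂ _*_ (withParity%2 p₁ (glP<2 k)) (withParity%2 s₁ (glS<2 k)))
                (cong₂ _*_ (withParity%2 q₁ (glQ<2 k)) (withParity%2 r₁ (glR<2 k))))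
             (gl-det-odd k))

  fromLifts : Lifts → GroupAut n
  fromLifts ((k , _) , (p₁ , _) , (q₁ , _) , (r₁ , _) , (s₁ , _)) = Inverse.groupAut p q r s (%2≡1⇒odd det-odd)
    where open Lift k p₁ q₁ r₁ s₁

  toLifts : GroupAut n → Lifts
  toLifts σ =
    glIndex (p % 2) (q % 2) (r % 2) (s % 2) ,
    (p / 2 , half< p (c₁< (proj₁ σ e₁))) , (q / 2 , half< q (c₁< (proj₁ σ e₂))) ,
    (r / 2 , half< r (c₂< (proj₁ σ e₁))) , (s / 2 , half< s (c₂< (proj₁ σ e₂)))
    where open Automorphism σ

  fromLifts-toLifts : ∀ σ → fromLifts (toLifts σ) ≈G σ
  fromLifts-toLifts σ x =
    trans (cong₄ (λ a b c e → lin a b c e x)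
                 (withParity-%2-/2 p (proj₁ gl)) (withParity-%2-/2 q (proj₁ (proj₂ gl)))
                 (withParity-%2-/2 r (proj₁ (proj₂ (proj₂ gl)))) (withParity-%2-/2 s (proj₂ (proj₂ (proj₂ gl)))))
          (sym (σ≡lin x))
    where
    open Automorphism σ
    gl = gl-glIndex (p % 2) (q % 2) (r % 2) (s % 2) (m%n<n p 2) (m%n<n q 2) (m%n<n r 2) (m%n<n s 2)
                    (trans (sym (Det-%2 p q r s)) Det-odd)

  toLifts-fromLifts : ∀ t → toLifts (fromLifts t) ≈Lifts t
  toLifts-fromLifts ((k , k<) , (p₁ , p₁<) , (q₁ , q₁<) , (r₁ , r₁<) , (s₁ , s₁<)) =
    trans (cong₄ (λ a b c e → proj₁ (glIndex (a % 2) (b % 2) (c % 2) (e % 2))) ep eq er es)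
          (trans (cong₄ (λ a b c e → proj₁ (glIndex a b c e)) (withParity%2 p₁ (glP<2 k)) (withParity%2 q₁ (glQ<2 k))
                                (withParity%2 r₁ (glR<2 k)) (withParity%2 s₁ (glS<2 k)))
                 (glIndex-gl k k<)) ,
    trans (cong (_/ 2) ep) (withParity/2 p₁ (glP<2 k)) ,
    trans (cong (_/ 2) eq) (withParity/2 q₁ (glQ<2 k)) ,
    trans (cong (_/ 2) er) (withParity/2 r₁ (glR<2 k)) ,
    trans (cong (_/ 2) es) (withParity/2 s₁ (glS<2 k))
    where
    open Lift k p₁ q₁ r₁ s₁
    columns = lin-columns p q r s (withParity< p₁ (glP<2 k) p₁<) (withParity< q₁ (glQ<2 k) q₁<)
                                  (withParity< r₁ (glR<2 k) r₁<) (withParity< s₁ (glS<2 k) s₁<)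
    ep = proj₁ columns
    er = proj₁ (proj₂ columns)
    eq = proj₁ (proj₂ (proj₂ columns))
    es = proj₂ (proj₂ (proj₂ columns))

  toLifts-resp : ∀ σ σ' → σ ≈G σ' → toLifts σ ≈Lifts toLifts σ'
  toLifts-resp σ σ' e =
    cong₄ (λ a b c d → proj₁ (glIndex (a % 2) (b % 2) (c % 2) (d % 2))) p≡ q≡ r≡ s≡ ,
    cong (_/ 2) p≡ , cong (_/ 2) q≡ , cong (_/ 2) r≡ , cong (_/ 2) s≡
    where
    p≡ = cong c₁ (e e₁)
    q≡ = cong c₁ (e e₂)
    r≡ = cong c₂ (e e₁)
    s≡ = cong c₂ (e e₂)

  fromLifts-resp : ∀ t t' → t ≈Lifts t' → fromLifts t ≈G fromLifts t'
  fromLifts-resp ((k , _) , (p₁ , _) , (q₁ , _) , (r₁ , _) , (s₁ , _))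
                 ((.k , _) , (.p₁ , _) , (.q₁ , _) , (.r₁ , _) , (.s₁ , _)) (refl , refl , refl , refl , refl) x = refl

  GroupAut-HasCard : HasCard (GroupAut n) _≈G_ (6 * (h * (h * (h * h))))
  GroupAut-HasCard = HasCard-transport fromLifts toLifts toLifts-resp fromLifts-resp fromLifts-toLifts toLifts-fromLifts
    (λ p q x → trans (p x) (q x)) Lifts-HasCard

-- Induced automorphisms

-- A matrix modulo odd scalars is normalised to  p = 1  when p is odd (then s has the
-- parity of 1 + q r, leaving q, r and s / 2 free), and to  r = 1  otherwise (then p is
-- even and q is odd, leaving p / 2, q / 2 and s free).
module InducedCount (n' : ℕ) where

  open GroupCount n'

  Normal₁ Normal₂ : Set
  Normal₁ = Below (2 ^ n) × (Below (2 ^ n) × Below h)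
  Normal₂ = Below h × (Below h × Below (2 ^ n))

  Normal : Set
  Normal = Normal₁ ⊎ Normal₂

  _≈Normal_ : Normal → Normal → Set
  _≈Normal_ = ⊎-Pointwise (×-Pointwise _≈Below_ (×-Pointwise _≈Below_ _≈Below_))
                          (×-Pointwise _≈Below_ (×-Pointwise _≈Below_ _≈Below_))

  Normal-HasCard : HasCard Normal _≈Normal_ ((2 ^ n * (2 ^ n * h)) + (h * (h * 2 ^ n)))
  Normal-HasCard = ⊎-HasCard (×-HasCard (Below-HasCard (2 ^ n)) (×-HasCard (Below-HasCard (2 ^ n)) (Below-HasCard h)))
                             (×-HasCard (Below-HasCard h) (×-HasCard (Below-HasCard h) (Below-HasCard (2 ^ n))))

  sParity : ℕ → ℕ → ℕ
  sParity q r = (1 + (q % 2) * (r % 2)) % 2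

  sParity<2 : ∀ q r → sParity q r < 2
  sParity<2 q r = m%n<n (1 + (q % 2) * (r % 2)) 2

  Matrix : Set
  Matrix = ℕ × ℕ × ℕ × ℕ

  matrix : Normal → Matrix
  matrix (inj₁ ((q , _) , (r , _) , (s₁ , _))) = 1 , q , r , withParity (sParity q r) s₁
  matrix (inj₂ ((p₁ , _) , (q₁ , _) , (s , _))) = withParity 0 p₁ , withParity 1 q₁ , 1 , s

  1*s+qr-odd : ∀ Q R → Q < 2 → R < 2 → (1 * ((1 + Q * R) % 2) + Q * R) % 2 ≡ 1
  1*s+qr-odd 0 0 _ _ = refl
  1*s+qr-odd 0 1 _ _ = refl
  1*s+qr-odd 1 0 _ _ = refl
  1*s+qr-odd 1 1 _ _ = refl
  1*s+qr-odd (suc (suc _)) _ (s≤s (s≤s ())) _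
  1*s+qr-odd _ (suc (suc _)) _ (s≤s (s≤s ()))

  matrix-det-odd : ∀ t → let (p , q , r , s) = matrix t in Det p q r s % 2 ≡ 1
  matrix-det-odd (inj₁ ((q , _) , (r , _) , (s₁ , _))) =
    trans (Det-%2 1 q r (withParity (sParity q r) s₁))
      (trans (cong (λ z → (1 * z + (q % 2) * (r % 2)) % 2) (withParity%2 s₁ (sParity<2 q r)))
             (1*s+qr-odd (q % 2) (r % 2) (m%n<n q 2) (m%n<n r 2)))
  matrix-det-odd (inj₂ ((p₁ , _) , (q₁ , _) , (s , _))) =
    trans (Det-%2 (withParity 0 p₁) (withParity 1 q₁) 1 s)
      (cong₂ (λ a b → (a * (s % 2) + b * 1) % 2) (withParity%2 p₁ (s≤s z≤n)) (withParity%2 q₁ (s≤s (s≤s z≤n))))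

  fromNormal : Normal → Induced n
  fromNormal t = Inverse.treeAut p q r s det-odd , Inverse.groupAut p q r s det-odd , (λ x → ∼-refl)
    where
    p = proj₁ (matrix t)
    q = proj₁ (proj₂ (matrix t))
    r = proj₁ (proj₂ (proj₂ (matrix t)))
    s = proj₂ (proj₂ (proj₂ (matrix t)))
    det-odd = %2≡1⇒odd (matrix-det-odd t)

  fromNormal-resp : ∀ t t' → t ≈Normal t' → fromNormal t ≈I fromNormal t'
  fromNormal-resp (inj₁ ((q , _) , (r , _) , (s₁ , _))) (inj₁ ((.q , _) , (.r , _) , (.s₁ , _)))
                  (inj₁ (refl , refl , refl)) x = ∼-refl
  fromNormal-resp (inj₂ ((p₁ , _) , (q₁ , _) , (s , _))) (inj₂ ((.p₁ , _) , (.q₁ , _) , (.s , _)))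
                  (inj₂ (refl , refl , refl)) x = ∼-refl

  normal₁ normal₂ : ℕ → ℕ → ℕ → Normal
  normal₁ a b c = inj₁ ((a % 2 ^ n , m%n<n a (2 ^ n)) , (b % 2 ^ n , m%n<n b (2 ^ n)) ,
                        ((c % 2 ^ n) / 2 , half< (c % 2 ^ n) (m%n<n c (2 ^ n))))
  normal₂ a b c = inj₂ (((a % 2 ^ n) / 2 , half< (a % 2 ^ n) (m%n<n a (2 ^ n))) ,
                        ((b % 2 ^ n) / 2 , half< (b % 2 ^ n) (m%n<n b (2 ^ n))) , (c % 2 ^ n , m%n<n c (2 ^ n)))

  normal₁-cong : ∀ {a b c a' b' c'} → a ≅ a' → b ≅ b' → c ≅ c' → normal₁ a b c ≈Normal normal₁ a' b' c'
  normal₁-cong ea eb ec = inj₁ (ea , eb , cong (_/ 2) ec)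

  normal₂-cong : ∀ {a b c a' b' c'} → a ≅ a' → b ≅ b' → c ≅ c' → normal₂ a b c ≈Normal normal₂ a' b' c'
  normal₂-cong ea eb ec = inj₂ (cong (_/ 2) ea , cong (_/ 2) eb , ec)

  normaliseBy : ℕ → ℕ → ℕ → ℕ → ℕ → Normal
  normaliseBy (suc _) p q r s = normal₁ (inv n p * q) (inv n p * r) (inv n p * s)
  normaliseBy zero    p q r s = normal₂ (inv n r * p) (inv n r * q) (inv n r * s)

  normalise : ℕ → ℕ → ℕ → ℕ → Normal
  normalise p q r s = normaliseBy (p % 2) p q r s

  normalise-≡ : ∀ {k} p q r s → p % 2 ≡ k → normalise p q r s ≡ normaliseBy k p q r s
  normalise-≡ p q r s e = cong (λ k → normaliseBy k p q r s) e

  toNormal : Induced n → Normal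
  toNormal ι = normalise p q r s
    where open Automorphism (proj₁ (proj₂ ι))

  inv-1 : inv n 1 ≡ 1
  inv-1 = trans (cong (_% 2 ^ n) (^-zeroˡ (2 ^ n ∸ 1))) (m<n⇒m%n≡m (2^-mono-< {0} {n} (s≤s z≤n)))

  inv-1*x : ∀ x → x < 2 ^ n → (inv n 1 * x) % 2 ^ n ≡ x
  inv-1*x x x< = trans (cong (λ z → (z * x) % 2 ^ n) inv-1) (trans (cong (_% 2 ^ n) (*-identityˡ x)) (m<n⇒m%n≡m x<))

  inv-1*withParity/2 : ∀ {b} x → b < 2 → x < h → ((inv n 1 * withParity b x) % 2 ^ n) / 2 ≡ x
  inv-1*withParity/2 x b< x< = trans (cong (_/ 2) (inv-1*x _ (withParity< x b< x<))) (withParity/2 x b<)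

  matrix< : ∀ t → let (p , q , r , s) = matrix t in p < 2 ^ n × q < 2 ^ n × r < 2 ^ n × s < 2 ^ n
  matrix< (inj₁ ((q , q<) , (r , r<) , (s₁ , s₁<))) = 1<2^n , q< , r< , withParity< s₁ (sParity<2 q r) s₁<
    where 1<2^n = 2^-mono-< {0} {n} (s≤s z≤n)
  matrix< (inj₂ ((p₁ , p₁<) , (q₁ , q₁<) , (s , s<))) =
    withParity< p₁ (s≤s z≤n) p₁< , withParity< q₁ (s≤s (s≤s z≤n)) q₁< , 2^-mono-< {0} {n} (s≤s z≤n) , s<

  normalise-matrix : ∀ t → let (p , q , r , s) = matrix t in normalise p q r s ≈Normal t
  normalise-matrix (inj₁ ((q , q<) , (r , r<) , (s₁ , s₁<))) =
    inj₁ (inv-1*x q q< , inv-1*x r r< , inv-1*withParity/2 s₁ (sParity<2 q r) s₁<)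
  normalise-matrix (inj₂ ((p₁ , p₁<) , (q₁ , q₁<) , (s , s<))) =
    subst (_≈Normal inj₂ ((p₁ , p₁<) , (q₁ , q₁<) , (s , s<)))
          (sym (normalise-≡ (withParity 0 p₁) (withParity 1 q₁) 1 s (withParity%2 p₁ (s≤s z≤n))))
          (inj₂ (inv-1*withParity/2 p₁ (s≤s z≤n) p₁< , inv-1*withParity/2 q₁ (s≤s (s≤s z≤n)) q₁< , inv-1*x s s<))

  toNormal-fromNormal : ∀ t → toNormal (fromNormal t) ≈Normal t
  toNormal-fromNormal t = subst (_≈Normal t) (sym (cong₄ normalise ep eq er es)) (normalise-matrix t)
    where
    columns = let (p< , q< , r< , s<) = matrix< t in lin-columns _ _ _ _ p< q< r< s<
    ep = proj₁ columns
    er = proj₁ (proj₂ columns)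
    eq = proj₁ (proj₂ (proj₂ columns))
    es = proj₂ (proj₂ (proj₂ columns))

  s-parity : ∀ S Q R → S < 2 → Q < 2 → R < 2 → (1 * S + Q * R) % 2 ≡ 1 → S ≡ (1 + Q * R) % 2
  s-parity 0 0 0 _ _ _ ()
  s-parity 0 0 1 _ _ _ ()
  s-parity 0 1 0 _ _ _ ()
  s-parity 0 1 1 _ _ _ _ = refl
  s-parity 1 0 0 _ _ _ _ = refl
  s-parity 1 0 1 _ _ _ _ = refl
  s-parity 1 1 0 _ _ _ _ = refl
  s-parity 1 1 1 _ _ _ ()
  s-parity (suc (suc _)) _ _ (s≤s (s≤s ())) _ _ _
  s-parity _ (suc (suc _)) _ _ (s≤s (s≤s ())) _ _
  s-parity _ _ (suc (suc _)) _ _ (s≤s (s≤s ())) _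

  q-r-odd : ∀ S Q R → Q < 2 → R < 2 → (0 * S + Q * R) % 2 ≡ 1 → Q ≡ 1 × R ≡ 1
  q-r-odd S 0 0 _ _ ()
  q-r-odd S 0 1 _ _ ()
  q-r-odd S 1 0 _ _ ()
  q-r-odd S 1 1 _ _ _ = refl , refl
  q-r-odd S (suc (suc _)) _ (s≤s (s≤s ())) _ _
  q-r-odd S _ (suc (suc _)) _ (s≤s (s≤s ())) _

  %2^n%2 : ∀ x → (x % 2 ^ n) % 2 ≡ x % 2
  %2^n%2 x = m∣n⇒o%n%m≡o%m 2 (2 ^ n) x (m∣m*n (2 ^ n'))

  q-r-odd-if-p-even : ∀ {p q r s} → Det p q r s % 2 ≡ 1 → p % 2 ≡ 0 → q % 2 ≡ 1 × r % 2 ≡ 1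
  q-r-odd-if-p-even {p} {q} {r} {s} det-odd p-even =
    q-r-odd (s % 2) (q % 2) (r % 2) (m%n<n q 2) (m%n<n r 2)
      (trans (cong (λ z → (z * (s % 2) + (q % 2) * (r % 2)) % 2) (sym p-even)) (trans (sym (Det-%2 p q r s)) det-odd))

  record Scaled (p q r s : ℕ) (N : Matrix) : Set where
    field
      w  : ℕ
      w-odd : Odd w
      ep : proj₁ N ≅ w * p
      eq : proj₁ (proj₂ N) ≅ w * q
      er : proj₁ (proj₂ (proj₂ N)) ≅ w * r
      es : proj₂ (proj₂ (proj₂ N)) ≅ w * s

  matrix-normalise-odd : ∀ p q r s → Det p q r s % 2 ≡ 1 → p % 2 ≡ 1 →
                         Scaled p q r s (matrix (normal₁ (inv n p * q) (inv n p * r) (inv n p * s)))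
  matrix-normalise-odd p q r s det-odd p-odd = record
    { w = w ; w-odd = w-odd ; ep = sym (inv-inverseˡ n (%2≡1⇒odd p-odd))
    ; eq = %-≅ (w * q) ; er = %-≅ (w * r)
    ; es = trans (cong (_% 2 ^ n) (withParity-%2-/2 s′ (sym s′-parity))) (%-≅ (w * s)) }
    where
    w = inv n p
    w-odd = odd-inv n (s≤s z≤n) (%2≡1⇒odd p-odd)
    q′ = (w * q) % 2 ^ n
    r′ = (w * r) % 2 ^ n
    s′ = (w * s) % 2 ^ n
    det′ : Det 1 q′ r′ s′ % 2 ≡ 1
    det′ = trans (%2^-reduce {1} {n} (s≤s z≤n)
                   (trans (Det-cong (sym (inv-inverseˡ n (%2≡1⇒odd p-odd))) (%-≅ (w * q)) (%-≅ (w * r)) (%-≅ (w * s)))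
                          (cong (_% 2 ^ n) (Det-scale w p q r s))))
                 (odd⇒%2≡1 (odd-* (odd-* w-odd w-odd) (%2≡1⇒odd det-odd)))
    s′-parity : s′ % 2 ≡ sParity q′ r′
    s′-parity = s-parity (s′ % 2) (q′ % 2) (r′ % 2) (m%n<n s′ 2) (m%n<n q′ 2) (m%n<n r′ 2)
                  (trans (sym (Det-%2 1 q′ r′ s′)) det′)

  matrix-normalise-even : ∀ p q r s → Det p q r s % 2 ≡ 1 → p % 2 ≡ 0 →
                          Scaled p q r s (matrix (normal₂ (inv n r * p) (inv n r * q) (inv n r * s)))
  matrix-normalise-even p q r s det-odd p-even = record
    { w = w ; w-odd = w-odd
    ; ep = trans (cong (_% 2 ^ n) (withParity-%2-/2 p′ (sym p′-even))) (%-≅ (w * p))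
    ; eq = trans (cong (_% 2 ^ n) (withParity-%2-/2 q′ (sym q′-odd))) (%-≅ (w * q))
    ; er = sym (inv-inverseˡ n r-odd) ; es = %-≅ (w * s) }
    where
    qr = q-r-odd-if-p-even {p} {q} {r} {s} det-odd p-even
    r-odd = %2≡1⇒odd (proj₂ qr)
    w = inv n r
    w-odd = odd-inv n (s≤s z≤n) r-odd
    p′ = (w * p) % 2 ^ n
    q′ = (w * q) % 2 ^ n
    p′-even : p′ % 2 ≡ 0
    p′-even = trans (%2^n%2 (w * p)) (*-%2≡0 w p p-even)
    q′-odd : q′ % 2 ≡ 1
    q′-odd = trans (%2^n%2 (w * q)) (odd⇒%2≡1 (odd-* w-odd (%2≡1⇒odd (proj₁ qr))))

  matrix-normalise : ∀ p q r s → Det p q r s % 2 ≡ 1 → Scaled p q r s (matrix (normalise p q r s))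
  matrix-normalise p q r s det-odd = by-parity (%2-cases p)
    where
    by-parity : (p % 2 ≡ 0) ⊎ (p % 2 ≡ 1) → Scaled p q r s (matrix (normalise p q r s))
    by-parity (inj₁ e) = subst (λ z → Scaled p q r s (matrix z)) (sym (normalise-≡ p q r s e))
                               (matrix-normalise-even p q r s det-odd e)
    by-parity (inj₂ e) = subst (λ z → Scaled p q r s (matrix z)) (sym (normalise-≡ p q r s e))
                               (matrix-normalise-odd p q r s det-odd e)

  fromNormal-toNormal : ∀ ι → fromNormal (toNormal ι) ≈I ι
  fromNormal-toNormal ι x =
    ∼-trans (≡⇒∼ scaled) (∼-trans (∼-sym (∼-intro (proj₁ σ x) (w · proj₁ σ x) w-odd refl)) (∼-sym (proj₂ (proj₂ ι) x)))
    where
    σ = proj₁ (proj₂ ι)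
    open Automorphism σ
    N = matrix (normalise p q r s)
    open Scaled (matrix-normalise p q r s Det-odd)
    scaled : lin (proj₁ N) (proj₁ (proj₂ N)) (proj₁ (proj₂ (proj₂ N))) (proj₂ (proj₂ (proj₂ N))) x ≡ w · proj₁ σ x
    scaled = trans (lin-cong x ep eq er es) (trans (lin-scale w p q r s x) (cong (w ·_) (sym (σ≡lin x))))

  record Scalar (y z : G n) : Set where
    field
      u     : ℕ
      u-odd : Odd u
      c₁≅   : c₁ z ≅ u * c₁ y
      c₂≅   : c₂ z ≅ u * c₂ y

  ∼⇒Scalar : ∀ {y z : G n} → y ∼ z → Scalar y z
  ∼⇒Scalar {y} {z} (u , (u-odd , _) , e) = record
    { u = u ; u-odd = u-odd
    ; c₁≅ = trans (cong (_% 2 ^ n) (cong c₁ e)) (c₁-mk-≅ (u * c₁ y) (u * c₂ y))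
    ; c₂≅ = trans (cong (_% 2 ^ n) (cong c₂ e)) (c₂-mk-≅ (u * c₁ y) (u * c₂ y)) }

  *-cancelʳ-odd : ∀ {D x y} → Odd D → x * D ≅ y * D → x ≅ y
  *-cancelʳ-odd {D} {x} {y} D-odd e = begin
    x % 2 ^ n             ≡⟨ cong (_% 2 ^ n) (sym (*-identityʳ x)) ⟩
    (x * 1) % 2 ^ n       ≡⟨ *-≅ {x} {x} {1} {w * D} refl (sym (inv-inverseˡ n D-odd)) ⟩
    (x * (w * D)) % 2 ^ n ≡⟨ cong (_% 2 ^ n) (regroup x w D) ⟩
    (x * D * w) % 2 ^ n   ≡⟨ *-≅ {x * D} {y * D} {w} e refl ⟩
    (y * D * w) % 2 ^ n   ≡⟨ cong (_% 2 ^ n) (sym (regroup y w D)) ⟩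
    (y * (w * D)) % 2 ^ n ≡⟨ *-≅ {y} {y} {w * D} {1} refl (inv-inverseˡ n D-odd) ⟩
    (y * 1) % 2 ^ n       ≡⟨ cong (_% 2 ^ n) (*-identityʳ y) ⟩
    y % 2 ^ n             ∎
    where
    open ≡-Reasoning
    w = inv n D
    regroup : ∀ x w D → x * (w * D) ≡ x * D * w
    regroup = solve-∀

  -- Multiplying the two equations by the adjugate gives  u₁ D ≡ u₃ D  and  u₂ D ≡ u₃ D.
  scalars-equal : ∀ {p q r s u₁ u₂ u₃} → Odd (Det p q r s) →
    u₁ * p + u₂ * q ≅ u₃ * p + u₃ * q → u₁ * r + u₂ * s ≅ u₃ * r + u₃ * s → u₁ ≅ u₃ × u₂ ≅ u₃
  scalars-equal {p} {q} {r} {s} {u₁} {u₂} {u₃} D-odd E₁ E₂ = *-cancelʳ-odd D-odd A , *-cancelʳ-odd D-odd B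
    where
    D = Det p q r s
    first : ∀ u₁ u₂ p q r s K → s * (u₁ * p + u₂ * q) + K * q * (u₁ * r + u₂ * s)
                                ≡ u₁ * (p * s + q * r * K) + (u₂ * q * s) * (1 + K)
    first = solve-∀
    second : ∀ u₁ u₂ p q r s K → p * (u₁ * r + u₂ * s) + K * r * (u₁ * p + u₂ * q)
                                 ≡ u₂ * (p * s + q * r * K) + (u₁ * p * r) * (1 + K)
    second = solve-∀
    A : u₁ * D ≅ u₃ * D
    A = trans (sym (+*2^n≅ (u₁ * D) (u₂ * q * s)))
          (trans (cong (_% 2 ^ n) (sym (first u₁ u₂ p q r s K)))
          (trans (+-≅ (*-≅ {s} refl E₁) (*-≅ {K * q} refl E₂))
          (trans (cong (_% 2 ^ n) (first u₃ u₃ p q r s K)) (+*2^n≅ (u₃ * D) (u₃ * q * s)))))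
    B : u₂ * D ≅ u₃ * D
    B = trans (sym (+*2^n≅ (u₂ * D) (u₁ * p * r)))
          (trans (cong (_% 2 ^ n) (sym (second u₁ u₂ p q r s K)))
          (trans (+-≅ (*-≅ {p} refl E₂) (*-≅ {K * r} refl E₁))
          (trans (cong (_% 2 ^ n) (second u₃ u₃ p q r s K)) (+*2^n≅ (u₃ * D) (u₃ * p * r)))))

  inverse-unique : ∀ {x y a} → x * a ≅ 1 → y * a ≅ 1 → x ≅ y
  inverse-unique {x} {y} {a} ex ey = begin
    x % 2 ^ n             ≡⟨ cong (_% 2 ^ n) (sym (*-identityʳ x)) ⟩
    (x * 1) % 2 ^ n       ≡⟨ *-≅ {x} {x} {1} {y * a} refl (sym ey) ⟩
    (x * (y * a)) % 2 ^ n ≡⟨ cong (_% 2 ^ n) (regroup x y a) ⟩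
    (x * a * y) % 2 ^ n   ≡⟨ *-≅ {x * a} {1} {y} ex refl ⟩
    (1 * y) % 2 ^ n       ≡⟨ cong (_% 2 ^ n) (*-identityˡ y) ⟩
    y % 2 ^ n             ∎
    where
    open ≡-Reasoning
    regroup : ∀ x y a → x * (y * a) ≡ x * a * y
    regroup = solve-∀

  ≅odd*⇒%2≡ : ∀ {u x x'} → Odd u → x' ≅ u * x → x' % 2 ≡ x % 2
  ≅odd*⇒%2≡ {u} {x} {x'} u-odd e = trans (sym (%2^n%2 x')) (trans (cong (_% 2) e) (trans (%2^n%2 (u * x)) (odd-*-%2 x u-odd)))

  *-≅-assoc : ∀ {w w' u X X'} → w' * u ≅ w → X' ≅ u * X → w' * X' ≅ w * X
  *-≅-assoc {w} {w'} {u} {X} {X'} e₁ e₂ =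
    trans (*-≅ {w'} refl e₂) (trans (cong (_% 2 ^ n) (sym (*-assoc w' u X))) (*-≅ {w' * u} {w} {X} e₁ refl))

  -- The normalising factor of  u·M  is  inv u  times that of M.
  normalise-scaled : ∀ {p q r s p' q' r' s' u} → Odd u → Det p q r s % 2 ≡ 1 →
                     p' ≅ u * p → q' ≅ u * q → r' ≅ u * r → s' ≅ u * s → normalise p q r s ≈Normal normalise p' q' r' s'
  normalise-scaled {p} {q} {r} {s} {p'} {q'} {r'} {s'} {u} u-odd det-odd ep eq er es = by-parity (%2-cases p)
    where
    p′%2 : p' % 2 ≡ p % 2
    p′%2 = ≅odd*⇒%2≡ u-odd ep
    factor : ∀ {a a'} → Odd a → Odd a' → a' ≅ u * a → inv n a' * u ≅ inv n a
    factor {a} {a'} a-odd a'-odd e =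
      inverse-unique {a = a} (trans (cong (_% 2 ^ n) (*-assoc (inv n a') u a))
                               (trans (*-≅ {inv n a'} refl (sym e)) (inv-inverseˡ n a'-odd)))
                             (inv-inverseˡ n a-odd)
    by-parity : (p % 2 ≡ 0) ⊎ (p % 2 ≡ 1) → normalise p q r s ≈Normal normalise p' q' r' s'
    by-parity (inj₂ e) =
      subst₂ _≈Normal_ (sym (normalise-≡ p q r s e)) (sym (normalise-≡ p' q' r' s' (trans p′%2 e)))
        (normal₁-cong (sym (rescale eq)) (sym (rescale er)) (sym (rescale es)))
      where
      rescale : ∀ {X X'} → X' ≅ u * X → inv n p' * X' ≅ inv n p * X
      rescale = *-≅-assoc {inv n p} {inv n p'} {u} (factor (%2≡1⇒odd e) (%2≡1⇒odd (trans p′%2 e)) ep)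
    by-parity (inj₁ e) =
      subst₂ _≈Normal_ (sym (normalise-≡ p q r s e)) (sym (normalise-≡ p' q' r' s' (trans p′%2 e)))
        (normal₂-cong (sym (rescale ep)) (sym (rescale eq)) (sym (rescale es)))
      where
      r%2 = proj₂ (q-r-odd-if-p-even {p} {q} {r} {s} det-odd e)
      rescale : ∀ {X X'} → X' ≅ u * X → inv n r' * X' ≅ inv n r * X
      rescale = *-≅-assoc {inv n r} {inv n r'} {u} (factor (%2≡1⇒odd r%2) (%2≡1⇒odd (trans (≅odd*⇒%2≡ u-odd er) r%2)) er)

  entries : GroupAut n → Matrix
  entries σ = p , q , r , s
    where open Automorphism σ

  σ-e₁⊕e₂ : ∀ (σ : GroupAut n) → let x = proj₁ σ e₁ ; y = proj₁ σ e₂ ; z = proj₁ σ (e₁ ⊕ e₂) in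
            c₁ z ≅ c₁ x + c₁ y × c₂ z ≅ c₂ x + c₂ y
  σ-e₁⊕e₂ σ = trans (cong (_% 2 ^ n) (trans (cong c₁ (σ-⊕ e₁ e₂)) (c₁-mk X Y))) (%-≅ X) ,
              trans (cong (_% 2 ^ n) (trans (cong c₂ (σ-⊕ e₁ e₂)) (c₂-mk X Y))) (%-≅ Y)
    where
    σ-⊕ = proj₁ (proj₂ σ)
    X = c₁ (proj₁ σ e₁) + c₁ (proj₁ σ e₂)
    Y = c₂ (proj₁ σ e₁) + c₂ (proj₁ σ e₂)

  -- Comparing the scalars on e₁, e₂ and e₁ + e₂ shows that they agree.
  same-orbits⇒scaled : ∀ σ σ' → (∀ x → proj₁ σ x ∼ proj₁ σ' x) →
    Scaled (Automorphism.p σ) (Automorphism.q σ) (Automorphism.r σ) (Automorphism.s σ) (entries σ')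
  same-orbits⇒scaled σ σ' same = record
    { w = S₃.u ; w-odd = S₃.u-odd
    ; ep = trans S₁.c₁≅ (*-≅ {S₁.u} {S₃.u} {p} u₁≅u₃ refl)
    ; eq = trans S₂.c₁≅ (*-≅ {S₂.u} {S₃.u} {q} u₂≅u₃ refl)
    ; er = trans S₁.c₂≅ (*-≅ {S₁.u} {S₃.u} {r} u₁≅u₃ refl)
    ; es = trans S₂.c₂≅ (*-≅ {S₂.u} {S₃.u} {s} u₂≅u₃ refl) }
    where
    open Automorphism σ
    module S₁ = Scalar (∼⇒Scalar (same e₁))
    module S₂ = Scalar (∼⇒Scalar (same e₂))
    module S₃ = Scalar (∼⇒Scalar (same (e₁ ⊕ e₂)))
    E₁ : S₁.u * p + S₂.u * q ≅ S₃.u * p + S₃.u * q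
    E₁ = begin
      (S₁.u * p + S₂.u * q) % 2 ^ n                       ≡⟨ sym (+-≅ S₁.c₁≅ S₂.c₁≅) ⟩
      (c₁ (proj₁ σ' e₁) + c₁ (proj₁ σ' e₂)) % 2 ^ n       ≡⟨ sym (proj₁ (σ-e₁⊕e₂ σ')) ⟩
      c₁ (proj₁ σ' (e₁ ⊕ e₂)) % 2 ^ n                     ≡⟨ S₃.c₁≅ ⟩
      (S₃.u * c₁ (proj₁ σ (e₁ ⊕ e₂))) % 2 ^ n             ≡⟨ *-≅ {S₃.u} refl (proj₁ (σ-e₁⊕e₂ σ)) ⟩
      (S₃.u * (p + q)) % 2 ^ n                            ≡⟨ cong (_% 2 ^ n) (*-distribˡ-+ S₃.u p q) ⟩
      (S₃.u * p + S₃.u * q) % 2 ^ n                       ∎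
      where open ≡-Reasoning
    E₂ : S₁.u * r + S₂.u * s ≅ S₃.u * r + S₃.u * s
    E₂ = begin
      (S₁.u * r + S₂.u * s) % 2 ^ n                       ≡⟨ sym (+-≅ S₁.c₂≅ S₂.c₂≅) ⟩
      (c₂ (proj₁ σ' e₁) + c₂ (proj₁ σ' e₂)) % 2 ^ n       ≡⟨ sym (proj₂ (σ-e₁⊕e₂ σ')) ⟩
      c₂ (proj₁ σ' (e₁ ⊕ e₂)) % 2 ^ n                     ≡⟨ S₃.c₂≅ ⟩
      (S₃.u * c₂ (proj₁ σ (e₁ ⊕ e₂))) % 2 ^ n             ≡⟨ *-≅ {S₃.u} refl (proj₂ (σ-e₁⊕e₂ σ)) ⟩
      (S₃.u * (r + s)) % 2 ^ n                            ≡⟨ cong (_% 2 ^ n) (*-distribˡ-+ S₃.u r s) ⟩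
      (S₃.u * r + S₃.u * s) % 2 ^ n                       ∎
      where open ≡-Reasoning
    u₁≅u₃ = proj₁ (scalars-equal {p} {q} {r} {s} {S₁.u} {S₂.u} {S₃.u} (%2≡1⇒odd Det-odd) E₁ E₂)
    u₂≅u₃ = proj₂ (scalars-equal {p} {q} {r} {s} {S₁.u} {S₂.u} {S₃.u} (%2≡1⇒odd Det-odd) E₁ E₂)

  toNormal-resp : ∀ ι ι' → ι ≈I ι' → toNormal ι ≈Normal toNormal ι'
  toNormal-resp ι ι' same = normalise-scaled {u = w} w-odd Det-odd ep eq er es
    where
    σ = proj₁ (proj₂ ι)
    open Automorphism σ
    open Scaled (same-orbits⇒scaled σ (proj₁ (proj₂ ι'))
                  (λ x → ∼-trans (∼-sym (proj₂ (proj₂ ι) x)) (∼-trans (same x) (proj₂ (proj₂ ι') x))))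

  Induced-HasCard : HasCard (Induced n) _≈I_ ((2 ^ n * (2 ^ n * h)) + (h * (h * 2 ^ n)))
  Induced-HasCard = HasCard-transport fromNormal toNormal toNormal-resp fromNormal-resp fromNormal-toNormal toNormal-fromNormal
    (λ p q x → ∼-trans (p x) (q x)) Normal-HasCard

labelAutCount≡ : ∀ m → labelAutCount m ≡ 3 * 2 ^ (3 * (2 ^ m ∸ 1) + 1)
labelAutCount≡ zero    = refl
labelAutCount≡ (suc m) = begin
  labelAutCount m * 2 ^ (3 * 2 ^ m)                     ≡⟨ cong (_* 2 ^ (3 * 2 ^ m)) (labelAutCount≡ m) ⟩
  3 * 2 ^ (3 * (2 ^ m ∸ 1) + 1) * 2 ^ (3 * 2 ^ m)       ≡⟨ *-assoc 3 (2 ^ (3 * (2 ^ m ∸ 1) + 1)) (2 ^ (3 * 2 ^ m)) ⟩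
  3 * (2 ^ (3 * (2 ^ m ∸ 1) + 1) * 2 ^ (3 * 2 ^ m))     ≡⟨ cong (3 *_) (^-distribˡ-+-* 2 (3 * (2 ^ m ∸ 1) + 1) (3 * 2 ^ m)) ⟨
  3 * 2 ^ (3 * (2 ^ m ∸ 1) + 1 + 3 * 2 ^ m)             ≡⟨ cong (λ z → 3 * 2 ^ z) (exponent (2 ^ m) (2^k>0 m)) ⟩
  3 * 2 ^ (3 * (2 * 2 ^ m ∸ 1) + 1)                     ∎
  where
  open ≡-Reasoning
  regroup : ∀ B → 3 * B + 1 + 3 * suc B ≡ 3 * suc (2 * B) + 1
  regroup = solve-∀
  exponent : ∀ A → 1 ≤ A → 3 * (A ∸ 1) + 1 + 3 * A ≡ 3 * (2 * A ∸ 1) + 1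
  exponent (suc B) _ = trans (regroup B) (cong (λ z → 3 * (z ∸ 1) + 1) (sym (+-suc (suc B) (B + 0))))

2^[4j] : ∀ j → 2 ^ (4 * j) ≡ 2 ^ j * (2 ^ j * (2 ^ j * 2 ^ j))
2^[4j] j = trans (cong (2 ^_) (*-comm 4 j))
             (trans (sym (^-*-assoc 2 j 4)) (cong (λ z → 2 ^ j * (2 ^ j * (2 ^ j * z))) (*-identityʳ (2 ^ j))))

2^[3j] : ∀ j → 2 ^ (3 * j) ≡ 2 ^ j * (2 ^ j * 2 ^ j)
2^[3j] j = trans (cong (2 ^_) (*-comm 3 j))
             (trans (sym (^-*-assoc 2 j 3)) (cong (λ z → 2 ^ j * (2 ^ j * z)) (*-identityʳ (2 ^ j))))

groupCount≡ : ∀ k → let H = 2 ^ suc k in 6 * (H * (H * (H * H))) ≡ 3 * 2 ^ (4 * suc (suc k) ∸ 3)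
groupCount≡ k = trans (regroup H) (cong (3 *_) (trans (cong (2 *_) (sym (2^[4j] (suc k)))) (cong (2 ^_) (sym exponent))))
  where
  H = 2 ^ suc k
  regroup : ∀ H → 6 * (H * (H * (H * H))) ≡ 3 * (2 * (H * (H * (H * H))))
  regroup = solve-∀
  split : ∀ k → 4 * suc (suc k) ≡ 3 + suc (4 * suc k)
  split = solve-∀
  exponent : 4 * suc (suc k) ∸ 3 ≡ suc (4 * suc k)
  exponent = trans (cong (_∸ 3) (split k)) (m+n∸m≡n 3 _)

inducedCount≡ : ∀ k → let H = 2 ^ suc k in (2 * H) * ((2 * H) * H) + H * (H * (2 * H)) ≡ 3 * 2 ^ (3 * suc (suc k) ∸ 2)
inducedCount≡ k = trans (regroup H) (cong (3 *_) (trans (cong (2 *_) (sym (2^[3j] (suc k)))) (cong (2 ^_) (sym exponent))))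
  where
  H = 2 ^ suc k
  regroup : ∀ H → (2 * H) * ((2 * H) * H) + H * (H * (2 * H)) ≡ 3 * (2 * (H * (H * H)))
  regroup = solve-∀
  split : ∀ k → 3 * suc (suc k) ≡ 2 + suc (3 * suc k)
  split = solve-∀
  exponent : 3 * suc (suc k) ∸ 2 ≡ suc (3 * suc k)
  exponent = trans (cong (_∸ 2) (split k)) (m+n∸m≡n 2 _)

lemma3p1 : ∀ (n : ℕ) → 2 ≤ n →
    HasCard (TreeAut n) _≈T_ (3 * 2 ^ (3 * (2 ^ (n ∸ 1) ∸ 1) + 1)) ×
    HasCard (GroupAut n) _≈G_ (3 * 2 ^ (4 * n ∸ 3)) ×
    HasCard (Induced n) _≈I_ (3 * 2 ^ (3 * n ∸ 2))
lemma3p1 (suc (suc k)) _ =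
  HasCard-≡ (labelAutCount≡ (suc k)) (TreeLabels.TreeAut-HasCard (suc k) (LabelAut-HasCard (suc k))) ,
  HasCard-≡ (groupCount≡ k) (GroupCount.GroupAut-HasCard (suc k)) ,
  HasCard-≡ (inducedCount≡ k) (InducedCount.Induced-HasCard (suc k))
lemma3p1 (suc zero) (s≤s ())
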